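{- For every tree $T$ with $n$ vertices, $s_2(K_2,T)\le s_2(K_2,P_n)$, where $P_n$ is the path on $n$ vertices, and equality holds only if $T=P_n$ or $T=K_{1,3}$.
   Context: All graphs are finite and simple. The distance between two edges $e,e'$ of a graph $G$ is the minimum of $\mathrm{dist}_G(v,v')$ over vertices $v$ incident to $e$ and $v'$ incident to $e'$ (so two edges sharing a vertex have distance $0$). A $2$-matching (induced matching) in $G$ is a set of edges of $G$ such that any two distinct edges in the set have distance at least $2$; the empty set counts as one. $s_2(K_2,G)$ denotes the number of $2$-matchings in $G$. -}

module Defs where

open import Data.Bool using (Bool; true; false; _∧_; _∨_; not; if_then_else_)
open import Data.Nat using (ℕ; zero; suc; _≡ᵇ_; _<ᵇ_; _<_)
open import Data.Fin using (Fin; toℕ) renaming (zero to fzero; suc to fsuc)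
open import Data.Fin.Properties using () renaming (_≟_ to _≟F_)
open import Data.List using (List; []; _∷_; _++_; map; concatMap; allFin; length; filterᵇ)
open import Data.Product using (Σ; _×_; _,_; ∃)
open import Data.Sum using (_⊎_)
open import Data.Empty using (⊥)
open import Relation.Nullary using (¬_)
open import Relation.Nullary.Decidable using (⌊_⌋)
open import Relation.Binary.PropositionalEquality using (_≡_; refl)
open import Data.List.Relation.Unary.AllPairs using (AllPairs)
open import Data.List.Relation.Unary.All using (All)
open import Function.Bundles using (_↔_; Inverse)
import Data.Nat.Properties as ℕP

record Graph (n : ℕ) : Set where
  field
    adj     : Fin n → Fin n → Bool
    symm    : ∀ i j → adj i j ≡ adj j i
    irrefl  : ∀ i → adj i i ≡ false
open Graph public

Adj : ∀ {n} → Graph n → Fin n → Fin n → Set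
Adj G i j = adj G i j ≡ true

data Walk {n : ℕ} (G : Graph n) : Fin n → Fin n → Set where
  here : ∀ {v} → Walk G v v
  step : ∀ {u w v} → Adj G u w → Walk G w v → Walk G u v

Connected : ∀ {n} → Graph n → Set
Connected G = ∀ u v → Walk G u v

Chain : ∀ {n} → Graph n → List (Fin n) → Set
Chain G []           = Data.Unit.⊤ where import Data.Unit
Chain G (x ∷ [])     = Data.Unit.⊤ where import Data.Unit
Chain G (x ∷ y ∷ xs) = Adj G x y × Chain G (y ∷ xs)

last : ∀ {A : Set} → A → List A → A
last a []       = a
last a (x ∷ xs) = last x xs

Cycle : ∀ {n} → Graph n → Set
Cycle {n} G =
  Σ (Fin n) λ v0 → Σ (Fin n) λ v1 → Σ (Fin n) λ v2 → Σ (List (Fin n)) λ rest →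
    AllPairs (λ a b → ¬ a ≡ b) (v0 ∷ v1 ∷ v2 ∷ rest)
    × Chain G (v0 ∷ v1 ∷ v2 ∷ rest)
    × Adj G (last v2 rest) v0

Acyclic : ∀ {n} → Graph n → Set
Acyclic G = ¬ Cycle G

IsTree : ∀ {n} → Graph n → Set
IsTree G = Connected G × Acyclic G

infix 4 _≅_
_≅_ : ∀ {n} → Graph n → Graph n → Set
_≅_ {n} G H = Σ (Fin n ↔ Fin n) λ σ →
  ∀ i j → adj G i j ≡ adj H (Inverse.to σ i) (Inverse.to σ j)

pathAdjℕ : ℕ → ℕ → Bool
pathAdjℕ a b = (suc a ≡ᵇ b) ∨ (suc b ≡ᵇ a)

private
  ∨-comm : ∀ x y → (x ∨ y) ≡ (y ∨ x)
  ∨-comm false false = refl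
  ∨-comm false true  = refl
  ∨-comm true  false = refl
  ∨-comm true  true  = refl

  suc≢ : ∀ a → (suc a ≡ᵇ a) ≡ false
  suc≢ zero    = refl
  suc≢ (suc a) = suc≢ a

Path : (n : ℕ) → Graph n
Path n = record
  { adj    = λ i j → pathAdjℕ (toℕ i) (toℕ j)
  ; symm   = λ i j → ∨-comm (suc (toℕ i) ≡ᵇ toℕ j) (suc (toℕ j) ≡ᵇ toℕ i)
  ; irrefl = λ i → irr (toℕ i)
  }
  where
  irr : ∀ a → pathAdjℕ a a ≡ false
  irr a rewrite suc≢ a = refl

isZero : ℕ → Bool
isZero zero    = true
isZero (suc _) = false

starAdjℕ : ℕ → ℕ → Bool
starAdjℕ a b = (isZero a ∧ not (isZero b)) ∨ (isZero b ∧ not (isZero a))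

Star : (n : ℕ) → Graph n
Star n = record
  { adj    = λ i j → starAdjℕ (toℕ i) (toℕ j)
  ; symm   = λ i j → ∨-comm (isZero (toℕ i) ∧ not (isZero (toℕ j)))
                            (isZero (toℕ j) ∧ not (isZero (toℕ i)))
  ; irrefl = λ i → irr (toℕ i)
  }
  where
  irr : ∀ a → starAdjℕ a a ≡ false
  irr zero    = refl
  irr (suc a) = refl

edges : ∀ {n} → Graph n → List (Fin n × Fin n)
edges {n} G =
  concatMap (λ i → concatMap (λ j →
     if (toℕ i <ᵇ toℕ j) ∧ adj G i j then (i , j) ∷ [] else []) (allFin n)) (allFin n)

-- Two vertices are at distance ≥ 2 iff they are distinct and non-adjacent.
far : ∀ {n} → Graph n → Fin n → Fin n → Bool
far G u v = not ⌊ u ≟F v ⌋ ∧ not (adj G u v)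

edgeFar : ∀ {n} → Graph n → Fin n × Fin n → Fin n × Fin n → Bool
edgeFar G (a , b) (c , d) = far G a c ∧ far G a d ∧ far G b c ∧ far G b d

-- All sub-lists (= all subsets of a duplicate-free list)
subsets : ∀ {A : Set} → List A → List (List A)
subsets []       = [] ∷ []
subsets (x ∷ xs) = subsets xs ++ map (x ∷_) (subsets xs)

allB : ∀ {A : Set} → (A → Bool) → List A → Bool
allB p []       = true
allB p (x ∷ xs) = p x ∧ allB p xs

isTwoMatching : ∀ {n} → Graph n → List (Fin n × Fin n) → Bool
isTwoMatching G []       = true
isTwoMatching G (e ∷ es) = allB (edgeFar G e) es ∧ isTwoMatching G es

-- s₂(K₂, G) : number of 2-matchings (including the empty one)
s2 : ∀ {n} → Graph n → ℕ
s2 G = length (filterᵇ (isTwoMatching G) (subsets (edges G)))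

-- A 2-matching of a tree T with a leaf v whose neighbour is u either avoids the edge uv (and
-- lives in T − v) or is uv together with a 2-matching far from u and v, i.e. one of T − N[u]:
--   s₂(T) = s₂(T − v) + s₂(T − N[u]).
-- For paths this gives s₂(Pₖ) = s₂(Pₖ₋₁) + s₂(Pₖ₋₃). The same bound s₂ ≤ s₂(Pₖ) is proved for every
-- vertex set of size k of a forest, by induction on k. If u has no other neighbour, u is isolated
-- in T − v and T − N[u] ⊆ T − u − v, so s₂(T) ≤ 2 s₂(Pₖ₋₂) ≤ s₂(Pₖ); otherwise T − N[u] also misses a
-- third vertex, so s₂(T) ≤ s₂(Pₖ₋₁) + s₂(Pₖ₋₃). In the case of equality both summands are extremal.
-- If u has two neighbours besides v, then T − N[u] misses four vertices and s₂(Pₖ₋₄) < s₂(Pₖ₋₃)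
-- unless k = 4, where T = K₁,₃. Otherwise T − v is, by induction, a path with u at one end, so T is a
-- path; T − v = K₁,₃ is impossible, since T − N[u] would then have no edges although s₂(P₂) = 2.

module Submission where

open import Defs
open import Data.Bool using (Bool; true; false; T; not; _∧_; if_then_else_; T?)
import Data.Bool.Properties as Bool
open import Data.Bool.Properties using (T-∧; T-≡; T-not-≡; ∧-comm; ∧-zeroʳ; ∧-identityʳ)
open import Data.Empty using (⊥; ⊥-elim)
open import Data.Unit using (tt)
open import Data.Fin using (Fin; toℕ; fromℕ<; opposite) renaming (zero to fzero; suc to fsuc)
import Data.Fin.Properties as Fin
open import Data.Fin.Properties
  using (¬Fin0; _≟_; any?; toℕ-injective; toℕ-fromℕ<; toℕ-fromℕ; toℕ<n; opposite-prop; opposite-involutive)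
open import Data.List using (List; []; _∷_; _++_; map; length; filterᵇ; concatMap; allFin; cartesianProduct)
open import Data.List.Properties using (length-++; filter-++; filter-all; filter-none)
open import Data.List.Membership.Propositional using (_∈_)
open import Data.List.Membership.Propositional.Properties
  using (∈-∃++; ∈-++⁺ˡ; ∈-++⁺ʳ; ∈-++⁻; ∈-filter⁺; ∈-filter⁻; ∈-allFin; ∈-cartesianProduct⁺)
open import Data.List.Relation.Unary.Any using (here; there)
import Data.List.Relation.Unary.Any as Any
open import Data.List.Relation.Unary.All using (All; []; _∷_)
import Data.List.Relation.Unary.All as All
import Data.List.Relation.Unary.All.Properties as All
open import Data.List.Relation.Unary.AllPairs using (AllPairs; []; _∷_)
open import Data.List.Relation.Unary.Unique.Propositional using (Unique)
import Data.List.Relation.Unary.Unique.Propositional.Properties as Unique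
import Data.Nat as ℕ
open import Data.Nat using (ℕ; zero; suc; _+_; _∸_; _≤_; _<_; z≤n; s≤s; _<ᵇ_; _≡ᵇ_)
open import Data.Nat.Properties
  using ( suc-injective; +-identityʳ; +-suc; +-comm; +-assoc; ≤-refl; ≤-trans; ≤-reflexive; m≤m+n
        ; n≤1+n; m∸n≤m; <⇒≢; ≤∧≢⇒<; ≡ᵇ⇒≡; ≡⇒≡ᵇ; ≤-pred; +-mono-≤; +-monoʳ-≤; +-monoʳ-<; m≤n⇒∃[o]m+o≡n
        ; +-mono-<-≤; +-cancelˡ-≡; m≤n⇒m<n∨m≡n; <-irrefl; 1+n≢0; 0≢1+n; <ᵇ⇒<; <⇒<ᵇ; <-asym; <-cmp
        ; module ≤-Reasoning)
open import Data.Nat.Tactic.RingSolver using (solve-∀)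
open import Data.Product using (Σ; ∃; ∃₂; _×_; _,_; proj₁; proj₂)
open import Data.Sum using (_⊎_; inj₁; inj₂)
open import Function using (_∘_; Equivalence)
open import Function.Bundles using (mk↔ₛ′)
open import Relation.Binary using (tri<; tri≈; tri>)
open import Relation.Binary.PropositionalEquality
  using (_≡_; _≢_; refl; sym; trans; cong; cong₂; subst; subst₂; module ≡-Reasoning)
open import Relation.Nullary using (¬_; Dec; yes; no; ⌊_⌋; ¬?; _×-dec_)
open import Relation.Nullary.Decidable using (toWitness; fromWitness; toWitnessFalse; fromWitnessFalse; map′)

length-filterᵇ-map : {A B : Set} (p : B → Bool) (f : A → B) (xs : List A) →
                     length (filterᵇ p (map f xs)) ≡ length (filterᵇ (p ∘ f) xs)
length-filterᵇ-map p f [] = refl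
length-filterᵇ-map p f (x ∷ xs) with p (f x)
... | true  = cong suc (length-filterᵇ-map p f xs)
... | false = length-filterᵇ-map p f xs

module _ {A : Set} where

  filterᵇ-cong-∈ : (p q : A → Bool) (xs : List A) → (∀ {x} → x ∈ xs → p x ≡ q x) →
                   filterᵇ p xs ≡ filterᵇ q xs
  filterᵇ-cong-∈ p q [] _ = refl
  filterᵇ-cong-∈ p q (x ∷ xs) eq with p x | q x | eq (here refl)
  ... | true  | true  | _ = cong (x ∷_) (filterᵇ-cong-∈ p q xs (eq ∘ there))
  ... | false | false | _ = filterᵇ-cong-∈ p q xs (eq ∘ there)

  filterᵇ-cong : (p q : A → Bool) (xs : List A) → (∀ x → p x ≡ q x) → filterᵇ p xs ≡ filterᵇ q xs
  filterᵇ-cong p q xs eq = filterᵇ-cong-∈ p q xs (λ {x} _ → eq x)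

  filterᵇ-filterᵇ : (p q : A → Bool) (xs : List A) →
                    filterᵇ p (filterᵇ q xs) ≡ filterᵇ (λ x → q x ∧ p x) xs
  filterᵇ-filterᵇ p q [] = refl
  filterᵇ-filterᵇ p q (x ∷ xs) with q x
  ... | false = filterᵇ-filterᵇ p q xs
  ... | true with p x
  ...   | true  = cong (x ∷_) (filterᵇ-filterᵇ p q xs)
  ...   | false = filterᵇ-filterᵇ p q xs

  filterᵇ-reject : {p : A → Bool} {x : A} (xs : List A) → p x ≡ false → filterᵇ p (x ∷ xs) ≡ filterᵇ p xs
  filterᵇ-reject xs px rewrite px = refl

  filterᵇ-reject-middle : {p : A → Bool} {x : A} (ys zs : List A) → p x ≡ false →
                          filterᵇ p (ys ++ x ∷ zs) ≡ filterᵇ p (ys ++ zs)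
  filterᵇ-reject-middle {p} {x} ys zs px = begin
    filterᵇ p (ys ++ x ∷ zs)           ≡⟨ filter-++ _ ys (x ∷ zs) ⟩
    filterᵇ p ys ++ filterᵇ p (x ∷ zs) ≡⟨ cong (filterᵇ p ys ++_) (filterᵇ-reject zs px) ⟩
    filterᵇ p ys ++ filterᵇ p zs       ≡⟨ sym (filter-++ _ ys zs) ⟩
    filterᵇ p (ys ++ zs) ∎
    where open ≡-Reasoning

module _ {A : Set} where

  countSublists : (List A → Bool) → List A → ℕ
  countSublists q xs = length (filterᵇ q (subsets xs))

  countSublists-∷ : (q : List A → Bool) (x : A) (xs : List A) →
    countSublists q (x ∷ xs) ≡ countSublists q xs + countSublists (q ∘ (x ∷_)) xs
  countSublists-∷ q x xs = begin
    length (filterᵇ q (subsets xs ++ map (x ∷_) (subsets xs)))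
      ≡⟨ cong length (filter-++ _ (subsets xs) _) ⟩
    length (filterᵇ q (subsets xs) ++ filterᵇ q (map (x ∷_) (subsets xs)))
      ≡⟨ length-++ (filterᵇ q (subsets xs)) ⟩
    countSublists q xs + length (filterᵇ q (map (x ∷_) (subsets xs)))
      ≡⟨ cong (countSublists q xs +_) (length-filterᵇ-map q (x ∷_) (subsets xs)) ⟩
    countSublists q xs + countSublists (q ∘ (x ∷_)) xs ∎
    where open ≡-Reasoning

  countSublists-cong : (q q′ : List A → Bool) (xs : List A) → (∀ s → q s ≡ q′ s) →
                       countSublists q xs ≡ countSublists q′ xs
  countSublists-cong q q′ xs eq = cong length (filterᵇ-cong q q′ (subsets xs) eq)

  countSublists-false : (xs : List A) → countSublists (λ _ → false) xs ≡ 0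
  countSublists-false []       = refl
  countSublists-false (x ∷ xs) = begin
    countSublists (λ _ → false) (x ∷ xs)                     ≡⟨ countSublists-∷ _ x xs ⟩
    countSublists (λ _ → false) xs + countSublists (λ _ → false) xs ≡⟨ cong₂ _+_ ih ih ⟩
    0 ∎
    where
    open ≡-Reasoning
    ih : countSublists (λ _ → false) xs ≡ 0
    ih = countSublists-false xs

  countSublists-allB : (p : A → Bool) (q : List A → Bool) (xs : List A) →
    countSublists (λ s → allB p s ∧ q s) xs ≡ countSublists q (filterᵇ p xs)
  countSublists-allB p q [] with q []
  ... | true  = refl
  ... | false = refl
  countSublists-allB p q (y ∷ ys) with p y in py
  ... | true = begin
    countSublists (λ s → allB p s ∧ q s) (y ∷ ys)
      ≡⟨ countSublists-∷ _ y ys ⟩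
    countSublists (λ s → allB p s ∧ q s) ys + countSublists (λ s → (p y ∧ allB p s) ∧ q (y ∷ s)) ys
      ≡⟨ cong (countSublists _ ys +_) (countSublists-cong _ _ ys (λ s → cong (λ b → (b ∧ allB p s) ∧ q (y ∷ s)) py)) ⟩
    countSublists (λ s → allB p s ∧ q s) ys + countSublists (λ s → allB p s ∧ q (y ∷ s)) ys
      ≡⟨ cong₂ _+_ (countSublists-allB p q ys) (countSublists-allB p (q ∘ (y ∷_)) ys) ⟩
    countSublists q (filterᵇ p ys) + countSublists (q ∘ (y ∷_)) (filterᵇ p ys)
      ≡⟨ sym (countSublists-∷ q y (filterᵇ p ys)) ⟩
    countSublists q (y ∷ filterᵇ p ys) ∎
    where open ≡-Reasoning
  ... | false = begin
    countSublists (λ s → allB p s ∧ q s) (y ∷ ys)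
      ≡⟨ countSublists-∷ _ y ys ⟩
    countSublists (λ s → allB p s ∧ q s) ys + countSublists (λ s → (p y ∧ allB p s) ∧ q (y ∷ s)) ys
      ≡⟨ cong (countSublists _ ys +_) (countSublists-cong _ _ ys (λ s → cong (λ b → (b ∧ allB p s) ∧ q (y ∷ s)) py)) ⟩
    countSublists (λ s → allB p s ∧ q s) ys + countSublists (λ _ → false) ys
      ≡⟨ cong₂ _+_ (countSublists-allB p q ys) (countSublists-false ys) ⟩
    countSublists q (filterᵇ p ys) + 0
      ≡⟨ +-identityʳ _ ⟩
    countSublists q (filterᵇ p ys) ∎
    where open ≡-Reasoning

unique-middle : {A : Set} {x e : A} (ys zs : List A) → Unique (ys ++ x ∷ zs) → e ∈ ys ++ zs → e ≢ x
unique-middle []       zs (x∉zs ∷ _) e∈zs refl = All.lookup x∉zs e∈zs refl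
unique-middle (y ∷ ys) zs (y∉ ∷ _) (here refl) refl = All.lookup y∉ (∈-++⁺ʳ ys (here refl)) refl
unique-middle (y ∷ ys) zs (_ ∷ u) (there e∈) = unique-middle ys zs u e∈

AllPairs-++⁻ˡ : {A : Set} {R : A → A → Set} (xs : List A) {ys : List A} →
                AllPairs R (xs ++ ys) → AllPairs R xs
AllPairs-++⁻ˡ []       _          = []
AllPairs-++⁻ˡ (x ∷ xs) (px ∷ pxs) = All.++⁻ˡ xs px ∷ AllPairs-++⁻ˡ xs pxs

∧-swapʳ : ∀ x y z → (x ∧ y) ∧ z ≡ (x ∧ z) ∧ y
∧-swapʳ true  y z = ∧-comm y z
∧-swapʳ false y z = refl

∧-exchange : ∀ x y z → x ∧ (y ∧ z) ≡ y ∧ (x ∧ z)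
∧-exchange true  y z = refl
∧-exchange false y z = sym (∧-zeroʳ y)

⌊≟⌋-sym : ∀ {n} (a b : Fin n) → ⌊ a ≟ b ⌋ ≡ ⌊ b ≟ a ⌋
⌊≟⌋-sym a b with a ≟ b | b ≟ a
... | yes _   | yes _   = refl
... | no _    | no _    = refl
... | yes a≡b | no b≢a  = ⊥-elim (b≢a (sym a≡b))
... | no a≢b  | yes b≡a = ⊥-elim (a≢b (sym b≡a))

⌊≟⌋-fsuc : ∀ {n} (a b : Fin n) → ⌊ fsuc a ≟ fsuc b ⌋ ≡ ⌊ a ≟ b ⌋
⌊≟⌋-fsuc a b with a ≟ b
... | yes _ = refl
... | no _  = refl

T-ext : ∀ {a b} → (T a → T b) → (T b → T a) → a ≡ b
T-ext {false} {false} _ _ = refl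
T-ext {false} {true}  _ g = ⊥-elim (g tt)
T-ext {true}  {false} f _ = ⊥-elim (f tt)
T-ext {true}  {true}  _ _ = refl

T-∧⁻ : ∀ {a b} → T (a ∧ b) → T a × T b
T-∧⁻ {a} = Equivalence.to (T-∧ {a})

T-∧⁺ : ∀ {a b} → T a → T b → T (a ∧ b)
T-∧⁺ {a} p q = Equivalence.from (T-∧ {a}) (p , q)

Edge : ℕ → Set
Edge n = Fin n × Fin n

module Matchings {n : ℕ} (G : Graph n) where

  far-sym : ∀ a b → far G a b ≡ far G b a
  far-sym a b = cong₂ (λ p q → not p ∧ not q) (⌊≟⌋-sym a b) (symm G a b)

  edgeFar-sym : ∀ e f → edgeFar G e f ≡ edgeFar G f e
  edgeFar-sym (a , b) (c , d) = begin
    far G a c ∧ (far G a d ∧ (far G b c ∧ far G b d))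
      ≡⟨ cong (far G a c ∧_) (∧-exchange (far G a d) (far G b c) (far G b d)) ⟩
    far G a c ∧ (far G b c ∧ (far G a d ∧ far G b d))
      ≡⟨ cong₂ _∧_ (far-sym a c) (cong₂ _∧_ (far-sym b c) (cong₂ _∧_ (far-sym a d) (far-sym b d))) ⟩
    far G c a ∧ (far G c b ∧ (far G d a ∧ far G d b)) ∎
    where open ≡-Reasoning

  matchings : List (Edge n) → ℕ
  matchings = countSublists (isTwoMatching G)

  matchings-∷ : ∀ x xs → matchings (x ∷ xs) ≡ matchings xs + matchings (filterᵇ (edgeFar G x) xs)
  matchings-∷ x xs = trans (countSublists-∷ _ x xs)
    (cong (matchings xs +_) (countSublists-allB (edgeFar G x) (isTwoMatching G) xs))

  matchings-∷-filterᵇ : ∀ y (p : Edge n → Bool) xs →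
    matchings (y ∷ filterᵇ p xs) ≡ matchings (filterᵇ p xs) + matchings (filterᵇ (λ e → p e ∧ edgeFar G y e) xs)
  matchings-∷-filterᵇ y p xs =
    trans (matchings-∷ y (filterᵇ p xs)) (cong (λ l → matchings (filterᵇ p xs) + matchings l) (filterᵇ-filterᵇ _ p xs))

  private
    interchange : ∀ a b c d → (a + b) + (c + d) ≡ (a + c) + (b + d)
    interchange = solve-∀

    interchange′ : ∀ a b c → (a + b) + c ≡ (a + c) + b
    interchange′ = solve-∀

  -- stated for filtered lists so that the induction on ys stays structural
  matchings-remove : ∀ x (p : Edge n → Bool) ys zs → p x ≡ true →
    matchings (filterᵇ p (ys ++ x ∷ zs)) ≡
    matchings (filterᵇ p (ys ++ zs)) + matchings (filterᵇ (λ e → p e ∧ edgeFar G x e) (ys ++ zs))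
  matchings-remove x p [] zs px rewrite px = matchings-∷-filterᵇ x p zs
  matchings-remove x p (y ∷ ys) zs px with p y | edgeFar G x y in xy
  ... | false | _    = matchings-remove x p ys zs px
  ... | true  | true = begin
    matchings (y ∷ filterᵇ p (ys ++ x ∷ zs))
      ≡⟨ matchings-∷-filterᵇ y p (ys ++ x ∷ zs) ⟩
    matchings (filterᵇ p (ys ++ x ∷ zs)) + matchings (filterᵇ q (ys ++ x ∷ zs))
      ≡⟨ cong₂ _+_ (matchings-remove x p ys zs px) (matchings-remove x q ys zs (cong₂ _∧_ px yx)) ⟩
    (A + B) + (C + matchings (filterᵇ (λ e → q e ∧ edgeFar G x e) (ys ++ zs)))
      ≡⟨ cong (λ l → (A + B) + (C + matchings l)) (filterᵇ-cong _ _ (ys ++ zs) (λ e → ∧-swapʳ (p e) _ _)) ⟩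
    (A + B) + (C + matchings (filterᵇ (λ e → (p e ∧ edgeFar G x e) ∧ edgeFar G y e) (ys ++ zs)))
      ≡⟨ interchange A B C _ ⟩
    (A + C) + (B + matchings (filterᵇ (λ e → (p e ∧ edgeFar G x e) ∧ edgeFar G y e) (ys ++ zs)))
      ≡⟨ cong₂ _+_ (matchings-∷-filterᵇ y p (ys ++ zs)) (matchings-∷-filterᵇ y _ (ys ++ zs)) ⟨
    matchings (y ∷ filterᵇ p (ys ++ zs)) + matchings (y ∷ filterᵇ (λ e → p e ∧ edgeFar G x e) (ys ++ zs)) ∎
    where
    open ≡-Reasoning
    q : Edge n → Bool
    q e = p e ∧ edgeFar G y e
    yx : edgeFar G y x ≡ true
    yx = trans (edgeFar-sym y x) xy
    A B C : ℕ
    A = matchings (filterᵇ p (ys ++ zs))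
    B = matchings (filterᵇ (λ e → p e ∧ edgeFar G x e) (ys ++ zs))
    C = matchings (filterᵇ q (ys ++ zs))
  ... | true  | false = begin
    matchings (y ∷ filterᵇ p (ys ++ x ∷ zs))
      ≡⟨ matchings-∷-filterᵇ y p (ys ++ x ∷ zs) ⟩
    matchings (filterᵇ p (ys ++ x ∷ zs)) + matchings (filterᵇ q (ys ++ x ∷ zs))
      ≡⟨ cong₂ _+_ (matchings-remove x p ys zs px) (cong matchings (filterᵇ-reject-middle ys zs (cong₂ _∧_ px yx))) ⟩
    (A + B) + matchings (filterᵇ q (ys ++ zs))
      ≡⟨ interchange′ A B _ ⟩
    (A + matchings (filterᵇ q (ys ++ zs))) + B
      ≡⟨ cong (_+ B) (matchings-∷-filterᵇ y p (ys ++ zs)) ⟨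
    matchings (y ∷ filterᵇ p (ys ++ zs)) + B ∎
    where
    open ≡-Reasoning
    q : Edge n → Bool
    q e = p e ∧ edgeFar G y e
    yx : edgeFar G y x ≡ false
    yx = trans (edgeFar-sym y x) xy
    A B : ℕ
    A = matchings (filterᵇ p (ys ++ zs))
    B = matchings (filterᵇ (λ e → p e ∧ edgeFar G x e) (ys ++ zs))

  matchings-split : ∀ x (p q : Edge n → Bool) (L : List (Edge n)) → Unique L → x ∈ L →
    p x ≡ true → q x ≡ false → (∀ {e} → e ∈ L → e ≢ x → p e ≡ q e) →
    matchings (filterᵇ p L) ≡ matchings (filterᵇ q L) + matchings (filterᵇ (λ e → q e ∧ edgeFar G x e) L)
  matchings-split x p q L uniq x∈L px qx agree with ∈-∃++ x∈L
  ... | ys , zs , refl = begin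
    matchings (filterᵇ p (ys ++ x ∷ zs))
      ≡⟨ matchings-remove x p ys zs px ⟩
    matchings (filterᵇ p (ys ++ zs)) + matchings (filterᵇ (λ e → p e ∧ edgeFar G x e) (ys ++ zs))
      ≡⟨ cong₂ (λ l l′ → matchings l + matchings l′) p≡q p≡q-far ⟩
    matchings (filterᵇ q (ys ++ x ∷ zs)) + matchings (filterᵇ (λ e → q e ∧ edgeFar G x e) (ys ++ x ∷ zs)) ∎
    where
    open ≡-Reasoning
    widen : ∀ {e} → e ∈ ys ++ zs → e ∈ ys ++ x ∷ zs
    widen e∈ with ∈-++⁻ ys e∈
    ... | inj₁ e∈ys = ∈-++⁺ˡ e∈ys
    ... | inj₂ e∈zs = ∈-++⁺ʳ ys (there e∈zs)
    agree′ : ∀ {e} → e ∈ ys ++ zs → p e ≡ q e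
    agree′ e∈ = agree (widen e∈) (unique-middle ys zs uniq e∈)
    p≡q : filterᵇ p (ys ++ zs) ≡ filterᵇ q (ys ++ x ∷ zs)
    p≡q = trans (filterᵇ-cong-∈ _ _ (ys ++ zs) agree′) (sym (filterᵇ-reject-middle ys zs qx))
    p≡q-far : filterᵇ (λ e → p e ∧ edgeFar G x e) (ys ++ zs) ≡ filterᵇ (λ e → q e ∧ edgeFar G x e) (ys ++ x ∷ zs)
    p≡q-far = trans (filterᵇ-cong-∈ _ _ (ys ++ zs) (λ e∈ → cong (_∧ _) (agree′ e∈)))
                    (sym (filterᵇ-reject-middle ys zs (cong (_∧ _) qx)))

module EdgeList {n : ℕ} (G : Graph n) where

  Oriented : Edge n → Bool
  Oriented (i , j) = (toℕ i <ᵇ toℕ j) ∧ adj G i j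

  edges-filter : edges G ≡ filterᵇ Oriented (cartesianProduct (allFin n) (allFin n))
  edges-filter = outer (allFin n)
    where
    inner : ∀ i js → concatMap (λ j → if Oriented (i , j) then (i , j) ∷ [] else []) js
                     ≡ filterᵇ Oriented (map (i ,_) js)
    inner i []       = refl
    inner i (j ∷ js) with Oriented (i , j)
    ... | true  = cong ((i , j) ∷_) (inner i js)
    ... | false = inner i js
    outer : ∀ is → concatMap (λ i → concatMap (λ j → if Oriented (i , j) then (i , j) ∷ [] else [])
                                              (allFin n)) is
                   ≡ filterᵇ Oriented (cartesianProduct is (allFin n))
    outer []       = refl
    outer (i ∷ is) = trans (cong₂ _++_ (inner i (allFin n)) (outer is))
                           (sym (filter-++ _ (map (i ,_) (allFin n)) _))

  edges-unique : Unique (edges G)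
  edges-unique rewrite edges-filter =
    Unique.filter⁺ (T? ∘ Oriented) (Unique.cartesianProduct⁺ (Unique.allFin⁺ n) (Unique.allFin⁺ n))

  ∈-edges⁻ : ∀ {e} → e ∈ edges G → T (Oriented e)
  ∈-edges⁻ e∈ rewrite edges-filter =
    proj₂ (∈-filter⁻ (T? ∘ Oriented) {xs = cartesianProduct (allFin n) (allFin n)} e∈)

  ∈-edges-Adj : ∀ {a b} → (a , b) ∈ edges G → Adj G a b
  ∈-edges-Adj {a} {b} e∈ = Equivalence.to T-≡ (proj₂ (T-∧⁻ {toℕ a <ᵇ toℕ b} (∈-edges⁻ e∈)))

  ∈-edges-< : ∀ {a b} → (a , b) ∈ edges G → toℕ a < toℕ b
  ∈-edges-< {a} {b} e∈ = <ᵇ⇒< (toℕ a) (toℕ b) (proj₁ (T-∧⁻ {toℕ a <ᵇ toℕ b} (∈-edges⁻ e∈)))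

  ∈-edges⁺ : ∀ {e} → T (Oriented e) → e ∈ edges G
  ∈-edges⁺ {i , j} o rewrite edges-filter =
    ∈-filter⁺ (T? ∘ Oriented) (∈-cartesianProduct⁺ (∈-allFin i) (∈-allFin j)) o

VertexSet : ℕ → Set
VertexSet n = Fin n → Bool

infix 4 _∈ᵥ_ _⊆ᵥ_

record _∈ᵥ_ {n : ℕ} (z : Fin n) (W : VertexSet n) : Set where
  constructor mem
  field unmem : T (W z)
open _∈ᵥ_

_⊆ᵥ_ : ∀ {n} → VertexSet n → VertexSet n → Set
V ⊆ᵥ W = ∀ {z} → z ∈ᵥ V → z ∈ᵥ W

full : ∀ {n} → VertexSet n
full _ = true

infixl 6 _∖_
_∖_ : ∀ {n} → VertexSet n → Fin n → VertexSet n
(W ∖ v) z = W z ∧ not ⌊ z ≟ v ⌋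

module _ {n : ℕ} where

  ∈-∖⁻ : ∀ {W : VertexSet n} {v z} → z ∈ᵥ W ∖ v → z ∈ᵥ W × z ≢ v
  ∈-∖⁻ {W} {z = z} (mem h) = let w , z≢v = T-∧⁻ {W z} h in mem w , toWitnessFalse z≢v

  ∈-∖⁺ : ∀ {W : VertexSet n} {v z} → z ∈ᵥ W → z ≢ v → z ∈ᵥ W ∖ v
  ∈-∖⁺ (mem w) z≢v = mem (T-∧⁺ w (fromWitnessFalse z≢v))

  ∖-⊆ : ∀ {W : VertexSet n} {v} → W ∖ v ⊆ᵥ W
  ∖-⊆ z∈ = proj₁ (∈-∖⁻ z∈)

  ∉-∖ : ∀ {W : VertexSet n} {v} → ¬ v ∈ᵥ W ∖ v
  ∉-∖ v∈ = proj₂ (∈-∖⁻ v∈) refl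

  ∈-∖∖⁻ : ∀ {W : VertexSet n} {v u z} → z ∈ᵥ W ∖ v ∖ u → z ∈ᵥ W × z ≢ v × z ≢ u
  ∈-∖∖⁻ z∈ = let z∈′ , z≢u = ∈-∖⁻ z∈ ; z∈W , z≢v = ∈-∖⁻ z∈′ in z∈W , z≢v , z≢u

  ∈-∖∖⁺ : ∀ {W : VertexSet n} {v u z} → z ∈ᵥ W → z ≢ v → z ≢ u → z ∈ᵥ W ∖ v ∖ u
  ∈-∖∖⁺ z∈W z≢v z≢u = ∈-∖⁺ (∈-∖⁺ z∈W z≢v) z≢u

size : ∀ {n} → VertexSet n → ℕ
size {zero}  W = 0
size {suc n} W = (if W fzero then 1 else 0) + size (W ∘ fsuc)

size-cong : ∀ {n} (V W : VertexSet n) → (∀ z → V z ≡ W z) → size V ≡ size W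
size-cong {zero}  V W eq = refl
size-cong {suc n} V W eq =
  cong₂ (λ b s → (if b then 1 else 0) + s) (eq fzero) (size-cong (V ∘ fsuc) (W ∘ fsuc) (eq ∘ fsuc))

size-mono : ∀ {n} (V W : VertexSet n) → V ⊆ᵥ W → size V ≤ size W
size-mono {zero}  V W V⊆W = z≤n
size-mono {suc n} V W V⊆W = +-mono-≤ head (size-mono (V ∘ fsuc) (W ∘ fsuc) (mem ∘ unmem ∘ V⊆W ∘ mem ∘ unmem))
  where
  head : (if V fzero then 1 else 0) ≤ (if W fzero then 1 else 0)
  head with V fzero | W fzero | (λ v → unmem (V⊆W {fzero} (mem v)))
  ... | false | _    | _  = z≤n
  ... | true  | true | _  = ≤-refl
  ... | true  | false | f = ⊥-elim (f tt)

size-full : ∀ n → size (full {n}) ≡ n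
size-full zero    = refl
size-full (suc n) = cong suc (size-full n)

size-empty : ∀ {n} (W : VertexSet n) → (∀ {z} → ¬ z ∈ᵥ W) → size W ≡ 0
size-empty {zero}  W _ = refl
size-empty {suc n} W empty with W fzero in w0
... | true  = ⊥-elim (empty {fzero} (mem (Equivalence.from T-≡ w0)))
... | false = size-empty (W ∘ fsuc) (λ z∈ → empty (mem (unmem z∈)))

∖-fsuc : ∀ {n} (W : VertexSet (suc n)) v z → ((W ∘ fsuc) ∖ v) z ≡ ((W ∖ fsuc v) ∘ fsuc) z
∖-fsuc W v z = cong (λ b → W (fsuc z) ∧ not b) (sym (⌊≟⌋-fsuc z v))

size-∖ : ∀ {n} (W : VertexSet n) {v} → v ∈ᵥ W → size W ≡ suc (size (W ∖ v))
size-∖ {suc n} W {fzero} (mem w0) with W fzero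
... | true = cong suc (size-cong (W ∘ fsuc) _ (λ z → sym (∧-identityʳ (W (fsuc z)))))
size-∖ {suc n} W {fsuc v} (mem wv) with W fzero
... | true  = cong suc (trans (size-∖ (W ∘ fsuc) (mem wv)) (cong suc (size-cong _ _ (∖-fsuc W v))))
... | false = trans (size-∖ (W ∘ fsuc) (mem wv)) (cong suc (size-cong _ _ (∖-fsuc W v)))

nonempty : ∀ {n} (W : VertexSet n) {k} → size W ≡ suc k → ∃ λ z → z ∈ᵥ W
nonempty W {k} size≡ with any? (λ z → T? (W z))
... | yes (z , w) = z , mem w
... | no none     = ⊥-elim (0≢1+n (trans (sym (size-empty W (λ z∈ → none (_ , unmem z∈)))) size≡))

size-0 : ∀ {n} (W : VertexSet n) → size W ≡ 0 → ∀ {z} → ¬ z ∈ᵥ W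
size-0 W size≡0 z∈ = 0≢1+n (trans (sym size≡0) (size-∖ W z∈))

size-singleton : ∀ {n} (W : VertexSet n) {x} → x ∈ᵥ W → (∀ {z} → z ∈ᵥ W → z ≡ x) → size W ≡ 1
size-singleton W x∈ only = trans (size-∖ W x∈) (cong suc (size-empty (W ∖ _) λ z∈ →
  let z∈W , z≢x = ∈-∖⁻ z∈ in z≢x (only z∈W)))

size-1-only : ∀ {n} (W : VertexSet n) → size W ≡ 1 → ∀ {x z} → x ∈ᵥ W → z ∈ᵥ W → z ≡ x
size-1-only W size≡1 {x} {z} x∈ z∈ with z ≟ x
... | yes z≡x = z≡x
... | no z≢x  = ⊥-elim (size-0 (W ∖ x) (suc-injective (trans (sym (size-∖ W x∈)) size≡1)) (∈-∖⁺ z∈ z≢x))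

-- Induced subgraphs and the leaf recurrence

module Induced {n : ℕ} (G : Graph n) where

  open Matchings G
  open EdgeList G

  Adj-sym : ∀ {a b} → Adj G a b → Adj G b a
  Adj-sym {a} {b} a~b = trans (symm G b a) a~b

  Adj-irrefl : ∀ {a b} → Adj G a b → a ≢ b
  Adj-irrefl {a} a~a refl with () ← trans (sym a~a) (irrefl G a)

  far⁻ : ∀ {u z} → T (far G u z) → u ≢ z × ¬ Adj G u z
  far⁻ {u} {z} h with T-∧⁻ {not ⌊ u ≟ z ⌋} h
  ... | u≢z , ¬u~z = toWitnessFalse u≢z , λ u~z → subst (T ∘ not) u~z ¬u~z

  far⁺ : ∀ {u z} → u ≢ z → ¬ Adj G u z → T (far G u z)
  far⁺ {u} {z} u≢z ¬u~z = T-∧⁺ (fromWitnessFalse u≢z) (Equivalence.from T-not-≡ (¬-true ¬u~z))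
    where
    ¬-true : ∀ {b} → b ≢ true → b ≡ false
    ¬-true {false} _  = refl
    ¬-true {true}  ne = ⊥-elim (ne refl)

  infixl 6 _∖N[_]
  _∖N[_] : VertexSet n → Fin n → VertexSet n
  (W ∖N[ u ]) z = W z ∧ far G u z

  ∈-∖N⁻ : ∀ {W u z} → z ∈ᵥ W ∖N[ u ] → z ∈ᵥ W × u ≢ z × ¬ Adj G u z
  ∈-∖N⁻ {W} {z = z} (mem h) = let z∈ , f = T-∧⁻ {W z} h in mem z∈ , far⁻ f

  ∈-∖N⁺ : ∀ {W u z} → z ∈ᵥ W → u ≢ z → ¬ Adj G u z → z ∈ᵥ W ∖N[ u ]
  ∈-∖N⁺ (mem z∈) u≢z ¬u~z = mem (T-∧⁺ z∈ (far⁺ u≢z ¬u~z))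

  inside : VertexSet n → Edge n → Bool
  inside W (a , b) = W a ∧ W b

  inside⁻ : ∀ {W a b} → T (inside W (a , b)) → a ∈ᵥ W × b ∈ᵥ W
  inside⁻ {W} {a} h = let a∈ , b∈ = T-∧⁻ {W a} h in mem a∈ , mem b∈

  inside⁺ : ∀ {W a b} → a ∈ᵥ W → b ∈ᵥ W → T (inside W (a , b))
  inside⁺ (mem a∈) (mem b∈) = T-∧⁺ a∈ b∈

  -- distances are measured in G; for edges inside W they agree with those in G[W]
  s2-induced : VertexSet n → ℕ
  s2-induced W = matchings (filterᵇ (inside W) (edges G))

  s2-induced-full : s2-induced full ≡ s2 G
  s2-induced-full = cong matchings (filter-all _ (All.universal (λ _ → tt) (edges G)))

  s2-induced-≗ : ∀ V W → (∀ z → V z ≡ W z) → s2-induced V ≡ s2-induced W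
  s2-induced-≗ V W V≗W = cong matchings (filterᵇ-cong _ _ (edges G) λ { (a , b) → cong₂ _∧_ (V≗W a) (V≗W b) })

  s2-induced-cong : ∀ V W → (∀ {a b} → Adj G a b → a ∈ᵥ V → b ∈ᵥ V → a ∈ᵥ W × b ∈ᵥ W) →
                            (∀ {a b} → Adj G a b → a ∈ᵥ W → b ∈ᵥ W → a ∈ᵥ V × b ∈ᵥ V) →
                    s2-induced V ≡ s2-induced W
  s2-induced-cong V W V→W W→V = cong matchings (filterᵇ-cong-∈ _ _ (edges G) same)
    where
    same : ∀ {e} → e ∈ edges G → inside V e ≡ inside W e
    same {a , b} e∈ = T-ext (λ h → let a∈ , b∈ = V→W a~b (proj₁ (inside⁻ h)) (proj₂ (inside⁻ h)) in inside⁺ a∈ b∈)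
                            (λ h → let a∈ , b∈ = W→V a~b (proj₁ (inside⁻ h)) (proj₂ (inside⁻ h)) in inside⁺ a∈ b∈)
      where a~b = ∈-edges-Adj e∈

  s2-induced-edgeless : ∀ W → (∀ {a b} → Adj G a b → a ∈ᵥ W → b ∈ᵥ W → ⊥) → s2-induced W ≡ 1
  s2-induced-edgeless W edgeless = cong matchings (filter-none _ (All.tabulate none))
    where
    none : ∀ {e} → e ∈ edges G → ¬ T (inside W e)
    none e∈ h = edgeless (∈-edges-Adj e∈) (proj₁ (inside⁻ h)) (proj₂ (inside⁻ h))

  orient : Fin n → Fin n → Edge n
  orient a b = if toℕ a <ᵇ toℕ b then (a , b) else (b , a)

  private
    <ᵇ-true : ∀ {m k} → m < k → (m <ᵇ k) ≡ true
    <ᵇ-true m<k = Equivalence.to T-≡ (<⇒<ᵇ m<k)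

    <ᵇ-false : ∀ {m k} → ¬ m < k → (m <ᵇ k) ≡ false
    <ᵇ-false {m} {k} m≮k with m <ᵇ k in lt
    ... | true  = ⊥-elim (m≮k (<ᵇ⇒< m k (subst T (sym lt) tt)))
    ... | false = refl

  orient-cases : ∀ a b → orient a b ≡ (a , b) ⊎ orient a b ≡ (b , a)
  orient-cases a b with toℕ a <ᵇ toℕ b
  ... | true  = inj₁ refl
  ... | false = inj₂ refl

  orient-∈ : ∀ {a b} → Adj G a b → orient a b ∈ edges G
  orient-∈ {a} {b} a~b with <-cmp (toℕ a) (toℕ b)
  ... | tri< a<b _ _ rewrite <ᵇ-true a<b = ∈-edges⁺ (T-∧⁺ (<⇒<ᵇ a<b) (Equivalence.from T-≡ a~b))
  ... | tri≈ _ a≡b _ = ⊥-elim (Adj-irrefl a~b (toℕ-injective a≡b))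
  ... | tri> a≮b _ b<a rewrite <ᵇ-false a≮b = ∈-edges⁺ (T-∧⁺ (<⇒<ᵇ b<a) (Equivalence.from T-≡ (Adj-sym a~b)))

  orient-∈-edges : ∀ {a b} → (a , b) ∈ edges G → orient a b ≡ (a , b)
  orient-∈-edges e∈ rewrite <ᵇ-true (∈-edges-< e∈) = refl

  orient-∈-edges-swap : ∀ {a b} → (a , b) ∈ edges G → orient b a ≡ (a , b)
  orient-∈-edges-swap e∈ rewrite <ᵇ-false (<-asym (∈-edges-< e∈)) = refl

  Far₂ : Fin n → Fin n → Fin n → Set
  Far₂ p q c = T (far G p c) × T (far G q c)

  edgeFar⁻ : ∀ {p q a b} → T (edgeFar G (p , q) (a , b)) → Far₂ p q a × Far₂ p q b
  edgeFar⁻ {p} {q} {a} {b} h =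
    let pa , h₁ = T-∧⁻ {far G p a} h ; pb , h₂ = T-∧⁻ {far G p b} h₁ ; qa , qb = T-∧⁻ {far G q a} h₂
    in (pa , qa) , (pb , qb)

  edgeFar⁺ : ∀ {p q a b} → Far₂ p q a → Far₂ p q b → T (edgeFar G (p , q) (a , b))
  edgeFar⁺ (pa , qa) (pb , qb) = T-∧⁺ pa (T-∧⁺ pb (T-∧⁺ qa qb))

  edgeFar-orient⁻ : ∀ {p q a b} → T (edgeFar G (orient p q) (a , b)) → Far₂ p q a × Far₂ p q b
  edgeFar-orient⁻ {p} {q} h with orient-cases p q
  ... | inj₁ eq = edgeFar⁻ (subst (λ x → T (edgeFar G x _)) eq h)
  ... | inj₂ eq = let (qa , pa) , (qb , pb) = edgeFar⁻ (subst (λ x → T (edgeFar G x _)) eq h)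
                  in (pa , qa) , (pb , qb)

  edgeFar-orient⁺ : ∀ {p q a b} → Far₂ p q a → Far₂ p q b → T (edgeFar G (orient p q) (a , b))
  edgeFar-orient⁺ {p} {q} (pa , qa) (pb , qb) with orient-cases p q
  ... | inj₁ eq = subst (λ x → T (edgeFar G x _)) (sym eq) (edgeFar⁺ (pa , qa) (pb , qb))
  ... | inj₂ eq = subst (λ x → T (edgeFar G x _)) (sym eq) (edgeFar⁺ (qa , pa) (qb , pb))

  record Leaf (W : VertexSet n) (v u : Fin n) : Set where
    field
      v∈ : v ∈ᵥ W
      u∈ : u ∈ᵥ W
      v~u : Adj G v u
      only : ∀ {z} → z ∈ᵥ W → Adj G v z → z ≡ u

  module _ {W : VertexSet n} {v u : Fin n} (leaf : Leaf W v u) where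
    open Leaf leaf

    far-leaf-edge⁻ : ∀ {c} → c ∈ᵥ W ∖N[ u ] → c ∈ᵥ W ∖ v × Far₂ v u c
    far-leaf-edge⁻ {c} c∈ with ∈-∖N⁻ c∈
    ... | c∈W , u≢c , ¬u~c = ∈-∖⁺ c∈W c≢v , far⁺ (c≢v ∘ sym) ¬v~c , far⁺ u≢c ¬u~c
      where
      c≢v : c ≢ v
      c≢v refl = ¬u~c (Adj-sym v~u)
      ¬v~c : ¬ Adj G v c
      ¬v~c v~c = u≢c (sym (only c∈W v~c))

    leaf-edge : ∀ {a b} → (a , b) ∈ edges G → a ∈ᵥ W → b ∈ᵥ W → a ≡ v ⊎ b ≡ v → (a , b) ≡ orient v u
    leaf-edge e∈ a∈ b∈ (inj₁ refl) with only b∈ (∈-edges-Adj e∈)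
    ... | refl = sym (orient-∈-edges e∈)
    leaf-edge e∈ a∈ b∈ (inj₂ refl) with only a∈ (Adj-sym (∈-edges-Adj e∈))
    ... | refl = sym (orient-∈-edges-swap e∈)

    leaf-edge-inside : T (inside W (orient v u))
    leaf-edge-inside with orient-cases v u
    ... | inj₁ eq rewrite eq = inside⁺ v∈ u∈
    ... | inj₂ eq rewrite eq = inside⁺ u∈ v∈

    leaf-edge-outside : inside (W ∖ v) (orient v u) ≡ false
    leaf-edge-outside = T-ext (λ h → ∉-∖ (v-end h)) λ ()
      where
      v-end : T (inside (W ∖ v) (orient v u)) → v ∈ᵥ W ∖ v
      v-end h with orient-cases v u
      ... | inj₁ eq rewrite eq = proj₁ (inside⁻ h)
      ... | inj₂ eq rewrite eq = proj₂ (inside⁻ h)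

    inside-∖-leaf : ∀ {e} → e ∈ edges G → e ≢ orient v u → inside W e ≡ inside (W ∖ v) e
    inside-∖-leaf {a , b} e∈ e≢x = T-ext
      (λ h → let a∈ , b∈ = inside⁻ {W} {a} {b} h
             in inside⁺ (∈-∖⁺ a∈ (λ a≡v → e≢x (leaf-edge e∈ a∈ b∈ (inj₁ a≡v))))
                        (∈-∖⁺ b∈ (λ b≡v → e≢x (leaf-edge e∈ a∈ b∈ (inj₂ b≡v)))))
      (λ h → let a∈ , b∈ = inside⁻ {W ∖ v} {a} {b} h in inside⁺ (∖-⊆ a∈) (∖-⊆ b∈))

    far-from-leaf-edge : ∀ e → inside (W ∖ v) e ∧ edgeFar G (orient v u) e ≡ inside (W ∖N[ u ]) e
    far-from-leaf-edge (a , b) = T-ext to from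
      where
      to : T (inside (W ∖ v) (a , b) ∧ edgeFar G (orient v u) (a , b)) → T (inside (W ∖N[ u ]) (a , b))
      to h = let i , f = T-∧⁻ {inside (W ∖ v) (a , b)} h ; a∈ , b∈ = inside⁻ {W ∖ v} {a} {b} i
                 (_ , ua) , (_ , ub) = edgeFar-orient⁻ {v} {u} {a} {b} f
                 u≢a , ¬u~a = far⁻ {u} {a} ua ; u≢b , ¬u~b = far⁻ {u} {b} ub
             in inside⁺ (∈-∖N⁺ (∖-⊆ a∈) u≢a ¬u~a) (∈-∖N⁺ (∖-⊆ b∈) u≢b ¬u~b)
      from : T (inside (W ∖N[ u ]) (a , b)) → T (inside (W ∖ v) (a , b) ∧ edgeFar G (orient v u) (a , b))
      from h = let a∈ , b∈ = inside⁻ {W ∖N[ u ]} {a} {b} h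
                   a∈′ , fa = far-leaf-edge⁻ a∈ ; b∈′ , fb = far-leaf-edge⁻ b∈
               in T-∧⁺ (inside⁺ a∈′ b∈′) (edgeFar-orient⁺ {v} {u} {a} {b} fa fb)

    leaf-recurrence : s2-induced W ≡ s2-induced (W ∖ v) + s2-induced (W ∖N[ u ])
    leaf-recurrence = begin
      s2-induced W
        ≡⟨ matchings-split (orient v u) (inside W) (inside (W ∖ v)) (edges G) edges-unique (orient-∈ v~u)
                           (Equivalence.to T-≡ leaf-edge-inside) leaf-edge-outside inside-∖-leaf ⟩
      s2-induced (W ∖ v) + matchings (filterᵇ (λ e → inside (W ∖ v) e ∧ edgeFar G (orient v u) e) (edges G))
        ≡⟨ cong (λ l → s2-induced (W ∖ v) + matchings l) (filterᵇ-cong _ _ (edges G) far-from-leaf-edge) ⟩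
      s2-induced (W ∖ v) + s2-induced (W ∖N[ u ]) ∎
      where open ≡-Reasoning

    u∈W∖v : u ∈ᵥ W ∖ v
    u∈W∖v = ∈-∖⁺ u∈ (λ u≡v → Adj-irrefl v~u (sym u≡v))

    size-leaf : size W ≡ suc (suc (size (W ∖ v ∖ u)))
    size-leaf = trans (size-∖ W v∈) (cong suc (size-∖ (W ∖ v) u∈W∖v))

    ∖N-⊆-leaf : W ∖N[ u ] ⊆ᵥ W ∖ v ∖ u
    ∖N-⊆-leaf z∈ with ∈-∖N⁻ z∈
    ... | z∈W , u≢z , ¬u~z = ∈-∖∖⁺ z∈W (λ z≡v → ¬u~z (subst (Adj G u) (sym z≡v) (Adj-sym v~u))) (u≢z ∘ sym)

  ∖N-⊆-∖ : ∀ {W X u w} → W ∖N[ u ] ⊆ᵥ X → Adj G u w → W ∖N[ u ] ⊆ᵥ X ∖ w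
  ∖N-⊆-∖ {W} {u = u} ⊆X u~w z∈ =
    ∈-∖⁺ (⊆X z∈) (λ z≡w → proj₂ (proj₂ (∈-∖N⁻ {W} {u} z∈)) (subst (Adj G u) (sym z≡w) u~w))

  s2-induced-isolated : ∀ X u → (∀ {z} → z ∈ᵥ X → ¬ Adj G u z) → s2-induced X ≡ s2-induced (X ∖ u)
  s2-induced-isolated X u isolated = s2-induced-cong X (X ∖ u)
    (λ a~b a∈ b∈ → ∈-∖⁺ a∈ (λ { refl → isolated b∈ a~b }) , ∈-∖⁺ b∈ (λ { refl → isolated a∈ (Adj-sym a~b) }))
    (λ _ a∈ b∈ → ∖-⊆ a∈ , ∖-⊆ b∈)

module _ {n : ℕ} (G : Graph n) where

  chain-prefix : ∀ a ys zs → Chain G (a ∷ ys ++ zs) → Chain G (a ∷ ys)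
  chain-prefix a []       zs _         = tt
  chain-prefix a (y ∷ ys) zs (a~y , c) = a~y , chain-prefix y ys zs c

  chain-last : ∀ a ys z zs → Chain G (a ∷ ys ++ z ∷ zs) → Adj G (last a ys) z
  chain-last a []       z zs (a~z , _) = a~z
  chain-last a (y ∷ ys) z zs (_ , c)   = chain-last y ys z zs c

module Leaves {n : ℕ} (G : Graph n) (acyclic : Acyclic G) where

  open Induced G

  Adj? : ∀ a b → Dec (Adj G a b)
  Adj? a b = adj G a b Bool.≟ true

  infix 4 _∈ᵥ?_
  _∈ᵥ?_ : ∀ z (W : VertexSet n) → Dec (z ∈ᵥ W)
  z ∈ᵥ? W = map′ mem unmem (T? (W z))

  -- the edge x ~ z closes the cycle z x p ys, where rest = ys ++ z ∷ zs
  path-cycle : ∀ x p rest {z} → Chain G (x ∷ p ∷ rest) → Unique (x ∷ p ∷ rest) → z ∈ rest →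
               Adj G x z → Cycle G
  path-cycle x p rest {z} ch (x∉ ∷ p∉ ∷ distinct) z∈rest x~z with ∈-∃++ z∈rest
  ... | ys , zs , refl =
    z , x , p , ys ,
    ((z≢x ∷ z≢p ∷ z∉ys) ∷ AllPairs-++⁻ˡ (x ∷ p ∷ ys) (x∉ ∷ p∉ ∷ distinct)) ,
    (Adj-sym x~z , chain-prefix G x (p ∷ ys) (z ∷ zs) ch) ,
    chain-last G p ys z zs (proj₂ ch)
    where
    z∈ : z ∈ ys ++ z ∷ zs
    z∈ = ∈-++⁺ʳ ys (here refl)
    z≢x : z ≢ x
    z≢x z≡x = All.lookup x∉ (there z∈) (sym z≡x)
    z≢p : z ≢ p
    z≢p z≡p = All.lookup p∉ z∈ (sym z≡p)
    z∉ys : All (z ≢_) ys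
    z∉ys = All.tabulate (λ y∈ys z≡y → unique-middle ys zs distinct (∈-++⁺ˡ y∈ys) (sym z≡y))

  private
    off-path : ∀ {x p z rest} → Adj G x z → z ≢ p → ¬ z ∈ rest → ¬ z ∈ x ∷ p ∷ rest
    off-path x~z z≢p z∉rest (here z≡x)          = Adj-irrefl x~z (sym z≡x)
    off-path x~z z≢p z∉rest (there (here z≡p))  = z≢p z≡p
    off-path x~z z≢p z∉rest (there (there z∈r)) = z∉rest z∈r

    -- Extend the path x p rest in W beyond x until x is a leaf; R holds the unvisited vertices of W.
    extend : ∀ k (R : VertexSet n) → size R ≡ k → ∀ {W} x p rest →
             x ∈ᵥ W → p ∈ᵥ W → Chain G (x ∷ p ∷ rest) → Unique (x ∷ p ∷ rest) →
             (∀ {z} → z ∈ᵥ W → ¬ z ∈ x ∷ p ∷ rest → z ∈ᵥ R) → ∃₂ (Leaf W)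
    extend k R size≡ {W} x p rest x∈ p∈ ch distinct unvisited
      with any? (λ (z : Fin n) → z ∈ᵥ? W ×-dec Adj? x z ×-dec ¬? (z ≟ p))
    ... | no none = x , p , record { v∈ = x∈ ; u∈ = p∈ ; v~u = proj₁ ch ; only = only }
      where
      only : ∀ {z} → z ∈ᵥ W → Adj G x z → z ≡ p
      only {z} z∈ x~z with z ≟ p
      ... | yes z≡p = z≡p
      ... | no z≢p  = ⊥-elim (none (z , z∈ , x~z , z≢p))
    ... | yes (z , z∈ , x~z , z≢p) with Any.any? (z ≟_) rest
    ...   | yes z∈rest = ⊥-elim (acyclic (path-cycle x p rest ch distinct z∈rest x~z))
    extend zero R size≡ x p rest x∈ p∈ ch distinct unvisited | yes (z , z∈ , x~z , z≢p) | no z∉rest =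
      ⊥-elim (0≢1+n (trans (sym size≡) (size-∖ R (unvisited z∈ (off-path x~z z≢p z∉rest)))))
    extend (suc k) R size≡ {W} x p rest x∈ p∈ ch distinct unvisited | yes (z , z∈ , x~z , z≢p) | no z∉rest =
      extend k (R ∖ z) (suc-injective (trans (sym (size-∖ R (unvisited z∈ z∉path))) size≡))
             z x (p ∷ rest) z∈ x∈ (Adj-sym x~z , ch) (All.¬Any⇒All¬ _ z∉path ∷ distinct) unvisited′
      where
      z∉path : ¬ z ∈ x ∷ p ∷ rest
      z∉path = off-path x~z z≢p z∉rest
      unvisited′ : ∀ {y} → y ∈ᵥ W → ¬ y ∈ z ∷ x ∷ p ∷ rest → y ∈ᵥ R ∖ z
      unvisited′ y∈ y∉ = ∈-∖⁺ (unvisited y∈ (y∉ ∘ there)) (y∉ ∘ here)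

  leaf-or-edgeless : ∀ W → (∀ {a b} → Adj G a b → a ∈ᵥ W → b ∈ᵥ W → ⊥) ⊎ ∃₂ (Leaf W)
  leaf-or-edgeless W with any? (λ (a : Fin n) → any? (λ b → a ∈ᵥ? W ×-dec b ∈ᵥ? W ×-dec Adj? a b))
  ... | no none = inj₁ (λ a~b a∈ b∈ → none (_ , _ , a∈ , b∈ , a~b))
  ... | yes (a , b , a∈ , b∈ , a~b) =
    inj₂ (extend _ (W ∖ a ∖ b) refl b a [] b∈ a∈ (Adj-sym a~b , tt)
                 ((Adj-irrefl (Adj-sym a~b) ∷ []) ∷ [] ∷ []) unvisited)
    where
    unvisited : ∀ {z} → z ∈ᵥ W → ¬ z ∈ b ∷ a ∷ [] → z ∈ᵥ W ∖ a ∖ b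
    unvisited z∈ z∉ = ∈-∖∖⁺ z∈ (z∉ ∘ there ∘ here) (z∉ ∘ here)

-- s₂ of paths

pathMatchings : ℕ → ℕ
pathMatchings 0 = 1
pathMatchings 1 = 1
pathMatchings 2 = 2
pathMatchings (suc (suc (suc k))) = pathMatchings (suc (suc k)) + pathMatchings k

pathMatchings-pos : ∀ k → 1 ≤ pathMatchings k
pathMatchings-pos 0 = ≤-refl
pathMatchings-pos 1 = ≤-refl
pathMatchings-pos 2 = s≤s z≤n
pathMatchings-pos (suc (suc (suc k))) = ≤-trans (pathMatchings-pos (suc (suc k))) (m≤m+n _ _)

pathMatchings-suc : ∀ k → pathMatchings k ≤ pathMatchings (suc k)
pathMatchings-suc 0 = ≤-refl
pathMatchings-suc 1 = s≤s z≤n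
pathMatchings-suc (suc (suc k)) = m≤m+n _ _

pathMatchings-mono : ∀ {j k} → j ≤ k → pathMatchings j ≤ pathMatchings k
pathMatchings-mono {j} {k} j≤k with m≤n⇒∃[o]m+o≡n j≤k
... | o , refl = go j o
  where
  go : ∀ j o → pathMatchings j ≤ pathMatchings (j + o)
  go j zero    rewrite +-identityʳ j = ≤-refl
  go j (suc o) rewrite +-suc j o     = ≤-trans (go j o) (pathMatchings-suc (j + o))

pathMatchings-strict : ∀ k → pathMatchings (suc k) < pathMatchings (suc (suc k))
pathMatchings-strict zero    = s≤s (s≤s z≤n)
pathMatchings-strict (suc k) = begin-strict
  pathMatchings (suc (suc k))                      ≡⟨ +-identityʳ _ ⟨
  pathMatchings (suc (suc k)) + 0                  <⟨ +-monoʳ-< (pathMatchings (suc (suc k))) (pathMatchings-pos k) ⟩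
  pathMatchings (suc (suc k)) + pathMatchings k    ∎
  where open ≤-Reasoning

pathMatchings-double : ∀ k → pathMatchings k + pathMatchings k ≤ pathMatchings (suc (suc k))
pathMatchings-double 0 = ≤-refl
pathMatchings-double 1 = s≤s (s≤s z≤n)
pathMatchings-double 2 = ≤-refl
pathMatchings-double (suc (suc (suc k))) = begin
  a₃ + a₃                                      ≡⟨⟩
  a₃ + (a₂ + pathMatchings k)                  ≤⟨ +-monoʳ-≤ a₃ (+-monoʳ-≤ a₂ (pathMatchings-suc k)) ⟩
  a₃ + (a₂ + pathMatchings (suc k))            ≡⟨ cong (a₃ +_) (+-comm a₂ _) ⟩
  a₃ + (pathMatchings (suc k) + a₂)            ≡⟨ +-assoc a₃ _ a₂ ⟨
  a₃ + pathMatchings (suc k) + a₂              ∎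
  where
  open ≤-Reasoning
  a₃ a₂ : ℕ
  a₃ = pathMatchings (suc (suc (suc k)))
  a₂ = pathMatchings (suc (suc k))

pathMatchings-rec : ∀ k → pathMatchings (suc (suc k)) ≡ pathMatchings (suc k) + pathMatchings (k ∸ 1)
pathMatchings-rec zero    = refl
pathMatchings-rec (suc k) = refl

pathAdj-irrefl : ∀ a → pathAdjℕ a a ≡ false
pathAdj-irrefl zero    = refl
pathAdj-irrefl (suc a) = pathAdj-irrefl a

pathAdj-sym : ∀ a b → pathAdjℕ a b ≡ pathAdjℕ b a
pathAdj-sym a b = Bool.∨-comm (suc a ≡ᵇ b) (suc b ≡ᵇ a)

pathAdj-pred : ∀ k → pathAdjℕ (suc k) k ≡ true
pathAdj-pred zero    = refl
pathAdj-pred (suc k) = pathAdj-pred k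

pathAdj-succ : ∀ k → pathAdjℕ (suc k) (suc (suc k)) ≡ true
pathAdj-succ k rewrite Equivalence.to T-≡ (≡⇒≡ᵇ k k refl) = refl

private
  ≡ᵇ-false : ∀ {x y} → x ≢ y → (x ≡ᵇ y) ≡ false
  ≡ᵇ-false {x} {y} x≢y = T-ext (λ t → ⊥-elim (x≢y (≡ᵇ⇒≡ x y t))) λ ()

  ∸-≡ᵇ-self : ∀ m b → b ≤ m → (m ∸ b ≡ᵇ m) ≡ (0 ≡ᵇ b)
  ∸-≡ᵇ-self m       zero    _         = Equivalence.to T-≡ (≡⇒≡ᵇ m m refl)
  ∸-≡ᵇ-self (suc m) (suc b) (s≤s b≤m) = ≡ᵇ-false (<⇒≢ (s≤s (m∸n≤m m b)))

  pathAdj-from-end : ∀ m b → suc b ≤ m → pathAdjℕ m (m ∸ suc b) ≡ pathAdjℕ 0 (suc b)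
  pathAdj-from-end (suc m) b (s≤s b≤m)
    rewrite ≡ᵇ-false {suc (suc m)} {m ∸ b} (<⇒≢ (s≤s (≤-trans (m∸n≤m m b) (n≤1+n m))) ∘ sym) =
    trans (∸-≡ᵇ-self m b b≤m) (sym (Bool.∨-identityʳ _))

pathAdj-reverse : ∀ m a b → a ≤ m → b ≤ m → pathAdjℕ (m ∸ a) (m ∸ b) ≡ pathAdjℕ a b
pathAdj-reverse m       zero    zero    _         _         = pathAdj-irrefl m
pathAdj-reverse (suc m) (suc a) (suc b) (s≤s a≤m) (s≤s b≤m) = pathAdj-reverse m a b a≤m b≤m
pathAdj-reverse m       zero    (suc b) _         b<m       = pathAdj-from-end m b b<m
pathAdj-reverse m       (suc a) zero    a<m       _         =
  trans (pathAdj-sym (m ∸ suc a) m) (trans (pathAdj-from-end m a a<m) (pathAdj-sym 0 (suc a)))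

module PathCount (n : ℕ) where

  open Induced (Path n)

  prefix : ℕ → VertexSet n
  prefix m z = toℕ z <ᵇ m

  private
    ⌊≟⌋-toℕ : ∀ (z y : Fin n) → ⌊ z ≟ y ⌋ ≡ (toℕ z ≡ᵇ toℕ y)
    ⌊≟⌋-toℕ z y = T-ext (λ z≡y → ≡⇒≡ᵇ _ _ (cong toℕ (toWitness z≡y)))
                        (λ t → fromWitness (toℕ-injective (≡ᵇ⇒≡ _ _ t)))

    drop-last : ∀ t k → (t <ᵇ suc (suc k)) ∧ not (t ≡ᵇ suc k) ≡ (t <ᵇ suc k)
    drop-last zero          k       = refl
    drop-last (suc zero)    zero    = refl
    drop-last (suc (suc t)) zero    = refl
    drop-last (suc t)       (suc k) = drop-last t k

    drop-last-three : ∀ t k → (t <ᵇ suc (suc k)) ∧ (not (k ≡ᵇ t) ∧ not (pathAdjℕ k t)) ≡ (t <ᵇ k ∸ 1)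
    drop-last-three zero          zero          = refl
    drop-last-three zero          (suc zero)    = refl
    drop-last-three zero          (suc (suc k)) = refl
    drop-last-three (suc zero)    zero          = refl
    drop-last-three (suc (suc t)) zero          = refl
    drop-last-three (suc t)       (suc zero)    = drop-last-three t zero
    drop-last-three (suc t)       (suc (suc k)) = drop-last-three t (suc k)

    last-neighbour : ∀ t k → T (t <ᵇ suc (suc k)) → pathAdjℕ (suc k) t ≡ true → t ≡ k
    last-neighbour zero          zero    _  _   = refl
    last-neighbour (suc zero)    zero    _  ()
    last-neighbour (suc (suc t)) zero    () _
    last-neighbour (suc t)       (suc k) t< adj = cong suc (last-neighbour t k t< adj)

    <ᵇ-1 : ∀ t → T (t <ᵇ 1) → t ≡ 0
    <ᵇ-1 zero _ = refl

    <ᵇ-suc : ∀ k → T (k <ᵇ suc k)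
    <ᵇ-suc zero    = tt
    <ᵇ-suc (suc k) = <ᵇ-suc k

    <ᵇ-suc-suc : ∀ k → T (k <ᵇ suc (suc k))
    <ᵇ-suc-suc zero    = tt
    <ᵇ-suc-suc (suc k) = <ᵇ-suc-suc k

  -- the last vertex of a prefix of length ≥ 2 is a leaf
  prefix-recurrence : ∀ k → suc (suc k) ≤ n →
    s2-induced (prefix (suc (suc k))) ≡ s2-induced (prefix (suc k)) + s2-induced (prefix (k ∸ 1))
  prefix-recurrence k 2+k≤n = begin
    s2-induced (prefix (suc (suc k)))                                     ≡⟨ leaf-recurrence leaf ⟩
    s2-induced (prefix (suc (suc k)) ∖ v) + s2-induced (prefix (suc (suc k)) ∖N[ u ])
      ≡⟨ cong₂ _+_ (s2-induced-≗ _ _ without-v) (s2-induced-≗ _ _ without-N[u]) ⟩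
    s2-induced (prefix (suc k)) + s2-induced (prefix (k ∸ 1))             ∎
    where
    open ≡-Reasoning
    v u : Fin n
    v = fromℕ< 2+k≤n
    u = fromℕ< (≤-trans (n≤1+n _) 2+k≤n)
    v≡ : toℕ v ≡ suc k
    v≡ = toℕ-fromℕ< 2+k≤n
    u≡ : toℕ u ≡ k
    u≡ = toℕ-fromℕ< (≤-trans (n≤1+n _) 2+k≤n)
    leaf : Leaf (prefix (suc (suc k))) v u
    leaf = record
      { v∈   = mem (subst (λ t → T (t <ᵇ suc (suc k))) (sym v≡) (<ᵇ-suc (suc k)))
      ; u∈   = mem (subst (λ t → T (t <ᵇ suc (suc k))) (sym u≡) (<ᵇ-suc-suc k))
      ; v~u  = subst₂ (λ a b → pathAdjℕ a b ≡ true) (sym v≡) (sym u≡) (pathAdj-pred k)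
      ; only = λ {z} z∈ v~z → toℕ-injective (trans (last-neighbour (toℕ z) k (unmem z∈)
                                (subst (λ a → pathAdjℕ a (toℕ z) ≡ true) v≡ v~z)) (sym u≡))
      }
    without-v : ∀ z → (prefix (suc (suc k)) ∖ v) z ≡ prefix (suc k) z
    without-v z = trans (cong (λ b → (toℕ z <ᵇ suc (suc k)) ∧ not b) (trans (⌊≟⌋-toℕ z v) (cong (toℕ z ≡ᵇ_) v≡)))
                        (drop-last (toℕ z) k)
    without-N[u] : ∀ z → (prefix (suc (suc k)) ∖N[ u ]) z ≡ prefix (k ∸ 1) z
    without-N[u] z = trans (cong₂ (λ b c → (toℕ z <ᵇ suc (suc k)) ∧ (not b ∧ not c))
                                  (trans (⌊≟⌋-toℕ u z) (cong (_≡ᵇ toℕ z) u≡))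
                                  (cong (λ a → pathAdjℕ a (toℕ z)) u≡))
                           (drop-last-three (toℕ z) k)

  s2-prefix : ∀ m → m ≤ n → s2-induced (prefix m) ≡ pathMatchings m
  s2-prefix zero          _    = s2-induced-edgeless (prefix 0) λ _ a∈ _ → unmem a∈
  s2-prefix (suc zero)    _    = s2-induced-edgeless _ λ {a} {b} a~b a∈ b∈ →
    Adj-irrefl a~b (toℕ-injective (trans (<ᵇ-1 (toℕ a) (unmem a∈)) (sym (<ᵇ-1 (toℕ b) (unmem b∈)))))
  s2-prefix (suc (suc k)) 2+k≤n = begin
    s2-induced (prefix (suc (suc k)))                          ≡⟨ prefix-recurrence k 2+k≤n ⟩
    s2-induced (prefix (suc k)) + s2-induced (prefix (k ∸ 1))
      ≡⟨ cong₂ _+_ (s2-prefix (suc k) (≤-trans (n≤1+n _) 2+k≤n)) (shorter k 2+k≤n) ⟩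
    pathMatchings (suc k) + pathMatchings (k ∸ 1)              ≡⟨ pathMatchings-rec k ⟨
    pathMatchings (suc (suc k))                                ∎
    where
    open ≡-Reasoning
    shorter : ∀ k → suc (suc k) ≤ n → s2-induced (prefix (k ∸ 1)) ≡ pathMatchings (k ∸ 1)
    shorter zero    _      = s2-prefix 0 z≤n
    shorter (suc j) 3+j≤n = s2-prefix j (≤-trans (n≤1+n _) (≤-trans (n≤1+n _) (≤-trans (n≤1+n _) 3+j≤n)))

  s2-Path : s2 (Path n) ≡ pathMatchings n
  s2-Path = begin
    s2 (Path n)            ≡⟨ s2-induced-full ⟨
    s2-induced full        ≡⟨ s2-induced-≗ full (prefix n) (λ z → sym (Equivalence.to T-≡ (<⇒<ᵇ (toℕ<n z)))) ⟩
    s2-induced (prefix n)  ≡⟨ s2-prefix n ≤-refl ⟩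
    pathMatchings n        ∎
    where open ≡-Reasoning

-- The upper bound

module UpperBound {n : ℕ} (G : Graph n) (acyclic : Acyclic G) where

  open Induced G
  open Leaves G acyclic

  module _ {W v u k} (leaf : Leaf W v u) (size≤ : size W ≤ suc k)
           (induction : ∀ X → size X ≤ k → s2-induced X ≤ pathMatchings (size X)) where

    open Leaf leaf

    private
      smaller : ∀ {X} → X ⊆ᵥ W ∖ v → size X ≤ k
      smaller X⊆ = ≤-trans (size-mono _ _ X⊆) (≤-pred (subst (_≤ suc k) (size-∖ W v∈) size≤))

    bound-no-other-neighbour : (∀ {z} → z ∈ᵥ W ∖ v ∖ u → ¬ Adj G u z) → s2-induced W ≤ pathMatchings (size W)
    bound-no-other-neighbour none = begin
      s2-induced W                                        ≡⟨ leaf-recurrence leaf ⟩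
      s2-induced (W ∖ v) + s2-induced (W ∖N[ u ])         ≡⟨ cong (_+ _) (s2-induced-isolated (W ∖ v) u isolated) ⟩
      s2-induced (W ∖ v ∖ u) + s2-induced (W ∖N[ u ])     ≤⟨ +-mono-≤ (induction _ (smaller ∖-⊆)) bound-N ⟩
      pathMatchings m + pathMatchings m                   ≤⟨ pathMatchings-double m ⟩
      pathMatchings (suc (suc m))                         ≡⟨ cong pathMatchings (size-leaf leaf) ⟨
      pathMatchings (size W)                              ∎
      where
      open ≤-Reasoning
      m : ℕ
      m = size (W ∖ v ∖ u)
      isolated : ∀ {z} → z ∈ᵥ W ∖ v → ¬ Adj G u z
      isolated {z} z∈ u~z = none (∈-∖⁺ z∈ (λ z≡u → Adj-irrefl u~z (sym z≡u))) u~z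
      bound-N : s2-induced (W ∖N[ u ]) ≤ pathMatchings m
      bound-N = ≤-trans (induction _ (smaller (∖-⊆ ∘ ∖N-⊆-leaf leaf)))
                        (pathMatchings-mono (size-mono _ _ (∖N-⊆-leaf leaf)))

    bound-other-neighbour : ∀ {w} → w ∈ᵥ W ∖ v ∖ u → Adj G u w → s2-induced W ≤ pathMatchings (size W)
    bound-other-neighbour {w} w∈ u~w = begin
      s2-induced W                                        ≡⟨ leaf-recurrence leaf ⟩
      s2-induced (W ∖ v) + s2-induced (W ∖N[ u ])         ≤⟨ +-mono-≤ (induction _ (smaller (λ z∈ → z∈))) bound-N ⟩
      pathMatchings (size (W ∖ v)) + pathMatchings m      ≡⟨ cong (λ s → pathMatchings s + pathMatchings m) size-W∖v ⟩
      pathMatchings (suc (suc (suc m)))                   ≡⟨ cong pathMatchings size-W ⟨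
      pathMatchings (size W)                              ∎
      where
      open ≤-Reasoning
      m : ℕ
      m = size (W ∖ v ∖ u ∖ w)
      size-W∖v : size (W ∖ v) ≡ suc (suc m)
      size-W∖v = trans (size-∖ (W ∖ v) (u∈W∖v leaf)) (cong suc (size-∖ (W ∖ v ∖ u) w∈))
      size-W : size W ≡ suc (suc (suc m))
      size-W = trans (size-∖ W v∈) (cong suc size-W∖v)
      bound-N : s2-induced (W ∖N[ u ]) ≤ pathMatchings m
      bound-N = ≤-trans (induction _ (smaller (∖-⊆ ∘ ∖N-⊆-leaf leaf)))
                        (pathMatchings-mono (size-mono _ _ (∖N-⊆-∖ {W} {u = u} (∖N-⊆-leaf leaf) u~w)))

  s2-induced-≤ : ∀ W → s2-induced W ≤ pathMatchings (size W)
  s2-induced-≤ W = bound (size W) W ≤-refl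
    where
    bound : ∀ k W → size W ≤ k → s2-induced W ≤ pathMatchings (size W)
    bound k W size≤ with leaf-or-edgeless W
    ... | inj₁ edgeless = subst (_≤ _) (sym (s2-induced-edgeless W edgeless)) (pathMatchings-pos (size W))
    bound zero W size≤ | inj₂ (v , u , leaf) with () ← subst (_≤ 0) (size-leaf leaf) size≤
    bound (suc k) W size≤ | inj₂ (v , u , leaf) with any? (λ (w : Fin n) → w ∈ᵥ? W ∖ v ∖ u ×-dec Adj? u w)
    ... | no none              = bound-no-other-neighbour leaf size≤ (bound k) (λ z∈ u~z → none (_ , z∈ , u~z))
    ... | yes (w , w∈ , u~w)   = bound-other-neighbour leaf size≤ (bound k) w∈ u~w

path-interior : ∀ {m} (i : Fin (suc m)) → toℕ i ≢ 0 → toℕ i ≢ m →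
  ∃₂ λ j₁ j₂ → j₁ ≢ j₂ × adj (Path (suc m)) i j₁ ≡ true × adj (Path (suc m)) i j₂ ≡ true
path-interior {m} i i≢0 i≢m with toℕ i in i≡ | toℕ<n i
... | zero  | _       = ⊥-elim (i≢0 refl)
... | suc t | s≤s t<m =
  fromℕ< t<1+m , fromℕ< t+2<1+m ,
  (λ j₁≡j₂ → t≢2+t (trans (sym (toℕ-fromℕ< t<1+m)) (trans (cong toℕ j₁≡j₂) (toℕ-fromℕ< t+2<1+m)))) ,
  trans (cong (pathAdjℕ (suc t)) (toℕ-fromℕ< t<1+m)) (pathAdj-pred t) ,
  trans (cong (pathAdjℕ (suc t)) (toℕ-fromℕ< t+2<1+m)) (pathAdj-succ t)
  where
  t<1+m : t < suc m
  t<1+m = ≤-trans (n≤1+n _) (s≤s t<m)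
  t+2<1+m : suc (suc t) < suc m
  t+2<1+m = s≤s (≤∧≢⇒< t<m i≢m)
  t≢2+t : ∀ {t} → t ≢ suc (suc t)
  t≢2+t {suc t} eq = t≢2+t (suc-injective eq)

module Labellings {n : ℕ} (G : Graph n) where

  open Induced G

  record Labelling (W : VertexSet n) {k : ℕ} (H : Graph k) : Set where
    field
      vertex     : Fin k → Fin n
      vertex∈    : ∀ i → vertex i ∈ᵥ W
      onto       : ∀ {z} → z ∈ᵥ W → ∃ λ i → vertex i ≡ z
      injective  : ∀ {i j} → vertex i ≡ vertex j → i ≡ j
      adj-vertex : ∀ i j → adj G (vertex i) (vertex j) ≡ adj H i j
  open Labelling

  labelling-≅ : ∀ {H : Graph n} → Labelling full H → G ≅ H
  labelling-≅ {H} L = mk↔ₛ′ index (vertex L) index-vertex vertex-index , adj-index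
    where
    index : Fin n → Fin n
    index z = proj₁ (onto L {z} (mem tt))
    vertex-index : ∀ z → vertex L (index z) ≡ z
    vertex-index z = proj₂ (onto L {z} (mem tt))
    index-vertex : ∀ i → index (vertex L i) ≡ i
    index-vertex i = injective L (vertex-index (vertex L i))
    adj-index : ∀ i j → adj G i j ≡ adj H (index i) (index j)
    adj-index i j = trans (sym (cong₂ (adj G) (vertex-index i) (vertex-index j))) (adj-vertex L (index i) (index j))

  empty-labelling : ∀ {W} → size W ≡ 0 → Labelling W (Path 0)
  empty-labelling {W} size≡0 = record
    { vertex = λ () ; vertex∈ = λ () ; injective = λ {i} → ⊥-elim (¬Fin0 i) ; adj-vertex = λ ()
    ; onto = λ z∈ → ⊥-elim (size-0 W size≡0 z∈) }

  singleton-labelling : ∀ {W x} → x ∈ᵥ W → (∀ {z} → z ∈ᵥ W → z ≡ x) → Labelling W (Path 1)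
  singleton-labelling {x = x} x∈ only = record
    { vertex = λ _ → x ; vertex∈ = λ _ → x∈ ; onto = λ z∈ → fzero , sym (only z∈)
    ; injective = λ { {fzero} {fzero} _ → refl } ; adj-vertex = λ { fzero fzero → irrefl G x } }

  prepend : ∀ {W v u m} → Leaf W v u → (L : Labelling (W ∖ v) (Path (suc m))) → vertex L fzero ≡ u →
            Labelling W (Path (suc (suc m)))
  prepend {W} {v} {u} {m} leaf L first≡u = record
    { vertex = vertex′ ; vertex∈ = vertex∈′ ; onto = onto′ ; injective = injective′ ; adj-vertex = adj′ }
    where
    open Leaf leaf
    vertex′ : Fin (suc (suc m)) → Fin n
    vertex′ fzero    = v
    vertex′ (fsuc i) = vertex L i
    vertex∈′ : ∀ i → vertex′ i ∈ᵥ W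
    vertex∈′ fzero    = v∈
    vertex∈′ (fsuc i) = ∖-⊆ (vertex∈ L i)
    vertex≢v : ∀ i → vertex L i ≢ v
    vertex≢v i = proj₂ (∈-∖⁻ (vertex∈ L i))
    onto′ : ∀ {z} → z ∈ᵥ W → ∃ λ i → vertex′ i ≡ z
    onto′ {z} z∈ with z ≟ v
    ... | yes z≡v = fzero , sym z≡v
    ... | no z≢v  = let i , eq = onto L (∈-∖⁺ z∈ z≢v) in fsuc i , eq
    injective′ : ∀ {i j} → vertex′ i ≡ vertex′ j → i ≡ j
    injective′ {fzero}  {fzero}  _  = refl
    injective′ {fzero}  {fsuc j} eq = ⊥-elim (vertex≢v j (sym eq))
    injective′ {fsuc i} {fzero}  eq = ⊥-elim (vertex≢v i eq)
    injective′ {fsuc i} {fsuc j} eq = cong fsuc (injective L eq)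
    v-row : ∀ j → adj G v (vertex L j) ≡ (0 ≡ᵇ toℕ j)
    v-row fzero    = trans (cong (adj G v) first≡u) v~u
    v-row (fsuc j) = T-ext (λ v~ → ⊥-elim (Fin.0≢1+n (sym (injective L (trans (only (∖-⊆ (vertex∈ L (fsuc j)))
                                                         (Equivalence.to T-≡ v~)) (sym first≡u))))))
                           λ ()
    adj′ : ∀ i j → adj G (vertex′ i) (vertex′ j) ≡ adj (Path (suc (suc m))) i j
    adj′ fzero    fzero    = irrefl G v
    adj′ fzero    (fsuc j) = trans (v-row j) (sym (Bool.∨-identityʳ _))
    adj′ (fsuc i) fzero    = trans (symm G (vertex L i) v) (v-row i)
    adj′ (fsuc i) (fsuc j) = adj-vertex L i j

  reverse : ∀ {W m} → Labelling W (Path m) → Labelling W (Path m)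
  reverse {W} {m} L = record
    { vertex = vertex L ∘ opposite
    ; vertex∈ = vertex∈ L ∘ opposite
    ; onto = λ z∈ → let i , eq = onto L z∈ in opposite i , trans (cong (vertex L) (opposite-involutive i)) eq
    ; injective = λ {i} {j} eq → trans (sym (opposite-involutive i))
                                  (trans (cong opposite (injective L eq)) (opposite-involutive j))
    ; adj-vertex = λ i j → trans (adj-vertex L (opposite i) (opposite j)) (reversed i j)
    }
    where
    reversed : ∀ {m} (i j : Fin m) → pathAdjℕ (toℕ (opposite i)) (toℕ (opposite j)) ≡ pathAdjℕ (toℕ i) (toℕ j)
    reversed {suc m} i j rewrite opposite-prop i | opposite-prop j =
      pathAdj-reverse m (toℕ i) (toℕ j) (≤-pred (toℕ<n i)) (≤-pred (toℕ<n j))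

  -- u cannot be an interior vertex of the path, so it is the first or the last one
  to-front : ∀ {W m u} → Labelling W (Path (suc m)) → u ∈ᵥ W →
             (∀ {a b} → a ∈ᵥ W → b ∈ᵥ W → Adj G u a → Adj G u b → a ≡ b) →
             Σ (Labelling W (Path (suc m))) λ L′ → vertex L′ fzero ≡ u
  to-front {m = m} L u∈ at-most-one with onto L u∈
  ... | i , refl with toℕ i ℕ.≟ 0 | toℕ i ℕ.≟ m
  ... | yes i≡0 | _       = L , cong (vertex L) (toℕ-injective (sym i≡0))
  ... | no _    | yes i≡m = reverse L , cong (vertex L) (toℕ-injective (trans (toℕ-fromℕ m) (sym i≡m)))
  ... | no i≢0  | no i≢m  with path-interior i i≢0 i≢m
  ...   | j₁ , j₂ , j₁≢j₂ , i~j₁ , i~j₂ = ⊥-elim (j₁≢j₂ (injective L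
            (at-most-one (vertex∈ L j₁) (vertex∈ L j₂) (trans (adj-vertex L i j₁) i~j₁)
                         (trans (adj-vertex L i j₂) i~j₂))))

  star-labelling : ∀ {W k} c (leaf : Fin k → Fin n) → c ∈ᵥ W → (∀ i → leaf i ∈ᵥ W) →
    (∀ {z} → z ∈ᵥ W → z ≢ c → ∃ λ i → leaf i ≡ z) → (∀ {i j} → leaf i ≡ leaf j → i ≡ j) →
    (∀ i → Adj G c (leaf i)) → (∀ {a b} → Adj G c a → Adj G c b → ¬ Adj G a b) →
    Labelling W (Star (suc k))
  star-labelling {W} {k} c leaf c∈ leaf∈ leaf-onto leaf-injective c~leaf triangle-free = record
    { vertex = vertex′ ; vertex∈ = vertex∈′ ; onto = onto′ ; injective = injective′ ; adj-vertex = adj′ }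
    where
    vertex′ : Fin (suc k) → Fin n
    vertex′ fzero    = c
    vertex′ (fsuc i) = leaf i
    vertex∈′ : ∀ i → vertex′ i ∈ᵥ W
    vertex∈′ fzero    = c∈
    vertex∈′ (fsuc i) = leaf∈ i
    onto′ : ∀ {z} → z ∈ᵥ W → ∃ λ i → vertex′ i ≡ z
    onto′ {z} z∈ with z ≟ c
    ... | yes z≡c = fzero , sym z≡c
    ... | no z≢c  = let i , eq = leaf-onto z∈ z≢c in fsuc i , eq
    injective′ : ∀ {i j} → vertex′ i ≡ vertex′ j → i ≡ j
    injective′ {fzero}  {fzero}  _  = refl
    injective′ {fzero}  {fsuc j} eq = ⊥-elim (Adj-irrefl (c~leaf j) eq)
    injective′ {fsuc i} {fzero}  eq = ⊥-elim (Adj-irrefl (c~leaf i) (sym eq))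
    injective′ {fsuc i} {fsuc j} eq = cong fsuc (leaf-injective eq)
    adj′ : ∀ i j → adj G (vertex′ i) (vertex′ j) ≡ adj (Star (suc k)) i j
    adj′ fzero    fzero    = irrefl G c
    adj′ fzero    (fsuc j) = c~leaf j
    adj′ (fsuc i) fzero    = Adj-sym (c~leaf i)
    adj′ (fsuc i) (fsuc j) =
      T-ext (λ i~j → ⊥-elim (triangle-free (c~leaf i) (c~leaf j) (Equivalence.to T-≡ i~j))) λ ()

  star-edges-meet : ∀ {X k u} → Labelling X (Star (suc (suc (suc k)))) → u ∈ᵥ X →
    (∀ {a b} → a ∈ᵥ X → b ∈ᵥ X → Adj G u a → Adj G u b → a ≡ b) →
    ∀ {a b} → a ∈ᵥ X → b ∈ᵥ X → Adj G a b → Adj G u a ⊎ Adj G u b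
  star-edges-meet L u∈ at-most-one a∈ b∈ a~b with onto L u∈ | onto L a∈ | onto L b∈
  ... | fzero , refl | _ | _ = ⊥-elim (1≢2 (injective L
          (at-most-one (vertex∈ L _) (vertex∈ L _) (adj-vertex L fzero (fsuc fzero))
                       (adj-vertex L fzero (fsuc (fsuc fzero))))))
    where
    1≢2 : ∀ {k} → fsuc {suc (suc k)} fzero ≢ fsuc (fsuc fzero)
    1≢2 ()
  ... | fsuc i , refl | fzero  , refl | _             = inj₁ (adj-vertex L (fsuc i) fzero)
  ... | fsuc i , refl | fsuc _ , refl | fzero , refl  = inj₂ (adj-vertex L (fsuc i) fzero)
  ... | fsuc i , refl | fsuc j , refl | fsuc l , refl with () ← trans (sym a~b) (adj-vertex L (fsuc j) (fsuc l))

module Connectivity {n : ℕ} (G : Graph n) where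

  open Induced G

  data WalkIn (W : VertexSet n) : Fin n → Fin n → Set where
    here : ∀ {x} → WalkIn W x x
    step : ∀ {x y z} → Adj G x y → y ∈ᵥ W → WalkIn W y z → WalkIn W x z

  ConnectedIn : VertexSet n → Set
  ConnectedIn W = ∀ {x y} → x ∈ᵥ W → y ∈ᵥ W → WalkIn W x y

  connected-full : Connected G → ConnectedIn full
  connected-full conn _ _ = walk (conn _ _)
    where
    walk : ∀ {x y} → Walk G x y → WalkIn full x y
    walk here         = here
    walk (step x~y r) = step x~y (mem tt) (walk r)

  connected-∖-leaf : ∀ {W v u} → Leaf W v u → ConnectedIn W → ConnectedIn (W ∖ v)
  connected-∖-leaf {W} {v} leaf conn x∈ y∈ =
    avoid (conn (∖-⊆ x∈) (∖-⊆ y∈)) (∖-⊆ x∈) (proj₂ (∈-∖⁻ x∈)) (proj₂ (∈-∖⁻ y∈))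
    where
    open Leaf leaf
    -- a walk through the leaf v enters and leaves it via u, so that detour can be cut out
    avoid : ∀ {x y} → WalkIn W x y → x ∈ᵥ W → x ≢ v → y ≢ v → WalkIn (W ∖ v) x y
    avoid here _ _ _ = here
    avoid {x} (step {y = w} x~w w∈ r) x∈ x≢v y≢v with w ≟ v
    ... | no w≢v = step x~w (∈-∖⁺ w∈ w≢v) (avoid r w∈ w≢v y≢v)
    ... | yes refl with r
    ...   | here = ⊥-elim (y≢v refl)
    ...   | step v~w′ w′∈ r′ with only w′∈ v~w′ | only x∈ (Adj-sym x~w)
    ...     | refl | refl = avoid r′ x∈ x≢v y≢v

  connected-isolated : ∀ {W x} → ConnectedIn W → x ∈ᵥ W → (∀ {z} → z ∈ᵥ W → ¬ Adj G x z) →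
                       ∀ {z} → z ∈ᵥ W → z ≡ x
  connected-isolated conn x∈ isolated z∈ with conn x∈ z∈
  ... | here          = refl
  ... | step x~y y∈ _ = ⊥-elim (isolated y∈ x~y)

-- The extremal trees

squeeze : ∀ {x y a b} → x ≤ a → y ≤ b → x + y ≡ a + b → x ≡ a × y ≡ b
squeeze {x} {y} {a} {b} x≤a y≤b eq with m≤n⇒m<n∨m≡n x≤a
... | inj₂ x≡a = x≡a , +-cancelˡ-≡ a y b (trans (cong (_+ y) (sym x≡a)) eq)
... | inj₁ x<a = ⊥-elim (<⇒≢ (+-mono-<-≤ x<a y≤b) eq)

module Extremal {n : ℕ} (G : Graph n) (acyclic : Acyclic G) where

  open Induced G
  open Leaves G acyclic
  open UpperBound G acyclic
  open Labellings G
  open Labelling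
  open Connectivity G

  triangle-free : ∀ {c a b} → Adj G c a → Adj G c b → ¬ Adj G a b
  triangle-free c~a c~b a~b = acyclic (_ , _ , _ , [] ,
    ((Adj-irrefl c~a ∷ Adj-irrefl c~b ∷ []) ∷ (Adj-irrefl a~b ∷ []) ∷ [] ∷ []) ,
    (c~a , a~b , tt) , Adj-sym c~b)

  Extremal : ℕ → VertexSet n → Set
  Extremal k W = Labelling W (Path k) ⊎ (k ≡ 4 × Labelling W (Star k))

  module Step {W v u} (leaf : Leaf W v u) (conn : ConnectedIn W) where

    open Leaf leaf

    no-other-neighbour : (∀ {z} → z ∈ᵥ W ∖ v ∖ u → ¬ Adj G u z) → size W ≡ 2 × Labelling W (Path 2)
    no-other-neighbour none = size-W , prepend leaf (singleton-labelling (u∈W∖v leaf) only-u) refl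
      where
      isolated : ∀ {z} → z ∈ᵥ W ∖ v → ¬ Adj G u z
      isolated z∈ u~z = none (∈-∖⁺ z∈ (λ z≡u → Adj-irrefl u~z (sym z≡u))) u~z
      only-u : ∀ {z} → z ∈ᵥ W ∖ v → z ≡ u
      only-u = connected-isolated (connected-∖-leaf leaf conn) (u∈W∖v leaf) isolated
      size-W : size W ≡ 2
      size-W = trans (size-∖ W v∈) (cong suc (size-singleton (W ∖ v) (u∈W∖v leaf) only-u))

    private
      N⊆ : ∀ {X w} → W ∖N[ u ] ⊆ᵥ X → Adj G u w → W ∖N[ u ] ⊆ᵥ X ∖ w
      N⊆ = ∖N-⊆-∖ {W} {u = u}

      s2-W∖v≤ : ∀ {k} → size (W ∖ v) ≡ k → s2-induced (W ∖ v) ≤ pathMatchings k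
      s2-W∖v≤ size≡ = ≤-trans (s2-induced-≤ (W ∖ v)) (≤-reflexive (cong pathMatchings size≡))

      s2-N≤ : ∀ {X} → W ∖N[ u ] ⊆ᵥ X → s2-induced (W ∖N[ u ]) ≤ pathMatchings (size X)
      s2-N≤ N⊆X = ≤-trans (s2-induced-≤ _) (pathMatchings-mono (size-mono _ _ N⊆X))

      size-W∖v : ∀ {w} → w ∈ᵥ W ∖ v ∖ u → size (W ∖ v) ≡ suc (suc (size (W ∖ v ∖ u ∖ w)))
      size-W∖v w∈ = trans (size-∖ (W ∖ v) (u∈W∖v leaf)) (cong suc (size-∖ (W ∖ v ∖ u) w∈))

    star-of-three-neighbours : ∀ {w w′} → w ∈ᵥ W ∖ v ∖ u → Adj G u w → w′ ∈ᵥ W ∖ v ∖ u ∖ w → Adj G u w′ →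
      size (W ∖ v ∖ u ∖ w ∖ w′) ≡ 0 → Labelling W (Star 4)
    star-of-three-neighbours {w} {w′} w∈ u~w w′∈ u~w′ size≡0 =
      star-labelling u leaf′ u∈ leaf∈ leaf-onto leaf-injective u~leaf triangle-free
      where
      w∈W : w ∈ᵥ W
      w∈W = proj₁ (∈-∖∖⁻ w∈)
      w≢v : w ≢ v
      w≢v = proj₁ (proj₂ (∈-∖∖⁻ w∈))
      w′∈W : w′ ∈ᵥ W
      w′∈W = proj₁ (∈-∖∖⁻ (proj₁ (∈-∖⁻ w′∈)))
      w′≢v : w′ ≢ v
      w′≢v = proj₁ (proj₂ (∈-∖∖⁻ (proj₁ (∈-∖⁻ w′∈))))
      w′≢w : w′ ≢ w
      w′≢w = proj₂ (∈-∖⁻ w′∈)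
      leaf′ : Fin 3 → Fin n
      leaf′ fzero               = v
      leaf′ (fsuc fzero)        = w
      leaf′ (fsuc (fsuc fzero)) = w′
      leaf∈ : ∀ i → leaf′ i ∈ᵥ W
      leaf∈ fzero               = v∈
      leaf∈ (fsuc fzero)        = w∈W
      leaf∈ (fsuc (fsuc fzero)) = w′∈W
      u~leaf : ∀ i → Adj G u (leaf′ i)
      u~leaf fzero               = Adj-sym v~u
      u~leaf (fsuc fzero)        = u~w
      u~leaf (fsuc (fsuc fzero)) = u~w′
      leaf-onto : ∀ {z} → z ∈ᵥ W → z ≢ u → ∃ λ i → leaf′ i ≡ z
      leaf-onto {z} z∈ z≢u with z ≟ v | z ≟ w | z ≟ w′
      ... | yes z≡v | _       | _        = fzero , sym z≡v
      ... | no _    | yes z≡w | _        = fsuc fzero , sym z≡w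
      ... | no _    | no _    | yes z≡w′ = fsuc (fsuc fzero) , sym z≡w′
      ... | no z≢v  | no z≢w  | no z≢w′  =
        ⊥-elim (size-0 (W ∖ v ∖ u ∖ w ∖ w′) size≡0 (∈-∖⁺ (∈-∖⁺ (∈-∖∖⁺ z∈ z≢v z≢u) z≢w) z≢w′))
      leaf-injective : ∀ {i j} → leaf′ i ≡ leaf′ j → i ≡ j
      leaf-injective {fzero}             {fzero}             _  = refl
      leaf-injective {fzero}             {fsuc fzero}        eq = ⊥-elim (w≢v (sym eq))
      leaf-injective {fzero}             {fsuc (fsuc fzero)} eq = ⊥-elim (w′≢v (sym eq))
      leaf-injective {fsuc fzero}        {fzero}             eq = ⊥-elim (w≢v eq)
      leaf-injective {fsuc fzero}        {fsuc fzero}        _  = refl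
      leaf-injective {fsuc fzero}        {fsuc (fsuc fzero)} eq = ⊥-elim (w′≢w (sym eq))
      leaf-injective {fsuc (fsuc fzero)} {fzero}             eq = ⊥-elim (w′≢v eq)
      leaf-injective {fsuc (fsuc fzero)} {fsuc fzero}        eq = ⊥-elim (w′≢w eq)
      leaf-injective {fsuc (fsuc fzero)} {fsuc (fsuc fzero)} _  = refl

    two-other-neighbours : ∀ {k w w′} → size W ≡ suc k → s2-induced W ≡ pathMatchings (suc k) →
      w ∈ᵥ W ∖ v ∖ u → Adj G u w → w′ ∈ᵥ W ∖ v ∖ u ∖ w → Adj G u w′ → k ≡ 3 × Labelling W (Star 4)
    two-other-neighbours {k} {w} {w′} size≡ eq w∈ u~w w′∈ u~w′ = cases m refl
      where
      m : ℕ
      m = size (W ∖ v ∖ u ∖ w ∖ w′)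
      size-W∖v′ : size (W ∖ v) ≡ 3 + m
      size-W∖v′ = trans (size-W∖v w∈) (cong (2 +_) (size-∖ (W ∖ v ∖ u ∖ w) w′∈))
      k≡ : k ≡ 3 + m
      k≡ = suc-injective (trans (sym size≡) (trans (size-∖ W v∈) (cong suc size-W∖v′)))
      bound : s2-induced W ≤ pathMatchings (3 + m) + pathMatchings m
      bound = begin
        s2-induced W                                  ≡⟨ leaf-recurrence leaf ⟩
        s2-induced (W ∖ v) + s2-induced (W ∖N[ u ])
          ≤⟨ +-mono-≤ (s2-W∖v≤ size-W∖v′) (s2-N≤ (N⊆ (N⊆ (∖N-⊆-leaf leaf) u~w) u~w′)) ⟩
        pathMatchings (3 + m) + pathMatchings m       ∎
        where open ≤-Reasoning
      cases : ∀ m′ → m ≡ m′ → k ≡ 3 × Labelling W (Star 4)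
      cases zero    m≡0 = trans k≡ (cong (3 +_) m≡0) , star-of-three-neighbours w∈ u~w w′∈ u~w′ m≡0
      cases (suc j) m≡  = ⊥-elim (<-irrefl eq (begin-strict
        s2-induced W                                            ≤⟨ bound ⟩
        pathMatchings (3 + m) + pathMatchings m
          ≡⟨ cong (λ s → pathMatchings (3 + s) + pathMatchings s) m≡ ⟩
        pathMatchings (3 + suc j) + pathMatchings (suc j)       <⟨ +-monoʳ-< _ (pathMatchings-strict j) ⟩
        pathMatchings (3 + suc j) + pathMatchings (suc (suc j))
          ≡⟨ cong (pathMatchings ∘ suc) (trans k≡ (cong (3 +_) m≡)) ⟨
        pathMatchings (suc k)                                   ∎))
        where open ≤-Reasoning

    private
      only-neighbour : ∀ {w} → (∀ {z} → z ∈ᵥ W ∖ v ∖ u ∖ w → ¬ Adj G u z) → ∀ {z} → z ∈ᵥ W ∖ v → Adj G u z → z ≡ w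
      only-neighbour {w} none {z} z∈ u~z with z ≟ w
      ... | yes z≡w = z≡w
      ... | no z≢w  = ⊥-elim (none (∈-∖⁺ (∈-∖⁺ z∈ (λ z≡u → Adj-irrefl u~z (sym z≡u))) z≢w) u~z)

      at-most-one : ∀ {w} → (∀ {z} → z ∈ᵥ W ∖ v ∖ u ∖ w → ¬ Adj G u z) →
                    ∀ {a b} → a ∈ᵥ W ∖ v → b ∈ᵥ W ∖ v → Adj G u a → Adj G u b → a ≡ b
      at-most-one none a∈ b∈ u~a u~b = trans (only-neighbour none a∈ u~a) (sym (only-neighbour none b∈ u~b))

    -- the centre of a star on W ∖ v would be adjacent to u, leaving W ∖ N[u] without edges
    s2-∖N-star : ∀ {w} → (∀ {z} → z ∈ᵥ W ∖ v ∖ u ∖ w → ¬ Adj G u z) → Labelling (W ∖ v) (Star 4) →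
                 s2-induced (W ∖N[ u ]) ≡ 1
    s2-∖N-star none S = s2-induced-edgeless _ edgeless
      where
      edgeless : ∀ {a b} → Adj G a b → a ∈ᵥ W ∖N[ u ] → b ∈ᵥ W ∖N[ u ] → ⊥
      edgeless a~b a∈ b∈ with star-edges-meet S (u∈W∖v leaf) (at-most-one none)
                                (∖-⊆ (∖N-⊆-leaf leaf a∈)) (∖-⊆ (∖N-⊆-leaf leaf b∈)) a~b
      ... | inj₁ u~a = proj₂ (proj₂ (∈-∖N⁻ {W} {u} a∈)) u~a
      ... | inj₂ u~b = proj₂ (proj₂ (∈-∖N⁻ {W} {u} b∈)) u~b

    one-other-neighbour : ∀ {k w} → size W ≡ suc k → s2-induced W ≡ pathMatchings (suc k) →
      w ∈ᵥ W ∖ v ∖ u → Adj G u w → (∀ {z} → z ∈ᵥ W ∖ v ∖ u ∖ w → ¬ Adj G u z) →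
      (s2-induced (W ∖ v) ≡ pathMatchings k → Extremal k (W ∖ v)) → Extremal (suc k) W
    one-other-neighbour {k} {w} size≡ eq w∈ u~w none induction
      with k≡ ← suc-injective (trans (sym size≡) (trans (size-∖ W v∈) (cong suc (size-W∖v w∈))))
      with squeeze (s2-W∖v≤ (size-W∖v w∈)) (s2-N≤ (N⊆ (∖N-⊆-leaf leaf) u~w))
                   (trans (sym (leaf-recurrence leaf)) (trans eq (cong (pathMatchings ∘ suc) k≡)))
    ... | eq-W∖v , eq-N with k≡
    ...   | refl with induction eq-W∖v
    ...     | inj₁ L =
      let L′ , first≡u = to-front L (u∈W∖v leaf) (at-most-one none) in inj₁ (prepend leaf L′ first≡u)
    ...     | inj₂ (size≡4 , S) =
      ⊥-elim (1≢2 (trans (sym (s2-∖N-star none (subst (Labelling (W ∖ v) ∘ Star) size≡4 S)))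
                         (trans eq-N (cong pathMatchings (suc-injective (suc-injective size≡4))))))
      where
      1≢2 : 1 ≢ 2
      1≢2 ()

  extremal-step : ∀ j W → size W ≡ suc (suc j) → ConnectedIn W → s2-induced W ≡ pathMatchings (suc (suc j)) →
    (∀ X → size X ≡ suc j → ConnectedIn X → s2-induced X ≡ pathMatchings (suc j) → Extremal (suc j) X) →
    Extremal (suc (suc j)) W
  extremal-step j W size≡ conn eq induction with leaf-or-edgeless W
  ... | inj₁ edgeless = ⊥-elim (1+n≢0 (suc-injective (trans (sym size≡) (size-singleton W x∈ only-x))))
    where
    x∈ : proj₁ (nonempty W size≡) ∈ᵥ W
    x∈ = proj₂ (nonempty W size≡)
    only-x : ∀ {z} → z ∈ᵥ W → z ≡ proj₁ (nonempty W size≡)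
    only-x = connected-isolated conn x∈ (λ z∈ x~z → edgeless x~z x∈ z∈)
  ... | inj₂ (v , u , leaf) with any? (λ (w : Fin n) → w ∈ᵥ? W ∖ v ∖ u ×-dec Adj? u w)
  ...   | no none with no-other-neighbour (λ z∈ u~z → none (_ , z∈ , u~z))
    where open Step leaf conn
  ...     | size-W , L with trans (sym size≡) size-W
  ...       | refl = inj₁ L
  extremal-step j W size≡ conn eq induction | inj₂ (v , u , leaf) | yes (w , w∈ , u~w)
    with any? (λ (w′ : Fin n) → w′ ∈ᵥ? W ∖ v ∖ u ∖ w ×-dec Adj? u w′)
  ... | yes (w′ , w′∈ , u~w′) with two-other-neighbours size≡ eq w∈ u~w w′∈ u~w′
    where open Step leaf conn
  ...   | refl , S = inj₂ (refl , S)
  extremal-step j W size≡ conn eq induction | inj₂ (v , u , leaf) | yes (w , w∈ , u~w) | no none =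
    one-other-neighbour size≡ eq w∈ u~w (λ z∈ u~z → none (_ , z∈ , u~z))
      (induction (W ∖ v) (suc-injective (trans (sym (size-∖ W (Leaf.v∈ leaf))) size≡))
                 (connected-∖-leaf leaf conn))
    where open Step leaf conn

  extremal : ∀ k W → size W ≡ k → ConnectedIn W → s2-induced W ≡ pathMatchings k → Extremal k W
  extremal zero          W size≡ _    _  = inj₁ (empty-labelling size≡)
  extremal (suc zero)    W size≡ _    _  =
    let x , x∈ = nonempty W size≡ in inj₁ (singleton-labelling x∈ (size-1-only W size≡ x∈))
  extremal (suc (suc j)) W size≡ conn eq = extremal-step j W size≡ conn eq (extremal (suc j))

theorem3p3 : (n : ℕ) (T : Graph n) → IsTree T →
    s2 T ≤ s2 (Path n) ×
    (s2 T ≡ s2 (Path n) → (T ≅ Path n) ⊎ (n ≡ 4 × T ≅ Star n))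
theorem3p3 n T (connected , acyclic) = upper , equality
  where
  open Induced T
  open UpperBound T acyclic
  open Connectivity T
  open Labellings T
  open Extremal T acyclic
  open PathCount n using (s2-Path)

  upper : s2 T ≤ s2 (Path n)
  upper = begin
    s2 T                             ≡⟨ s2-induced-full ⟨
    s2-induced full                  ≤⟨ s2-induced-≤ full ⟩
    pathMatchings (size (full {n}))  ≡⟨ cong pathMatchings (size-full n) ⟩
    pathMatchings n                  ≡⟨ s2-Path ⟨
    s2 (Path n)                      ∎
    where open ≤-Reasoning

  equality : s2 T ≡ s2 (Path n) → (T ≅ Path n) ⊎ (n ≡ 4 × T ≅ Star n)
  equality eq with extremal n full (size-full n) (connected-full connected)
                            (trans s2-induced-full (trans eq s2-Path))
  ... | inj₁ L         = inj₁ (labelling-≅ L)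
  ... | inj₂ (n≡4 , S) = inj₂ (n≡4 , labelling-≅ S)
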